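{- Let $p,q$ be positive integers with $p/q\ge4$, $k=\lfloor p/q\rfloor$, $r=p-kq\ge1$, let $G$ be a graph and $G'$ the graph constructed from $G$ as in the context. Let $h,h'$ be $k$-colourings of $G$ which differ on exactly one vertex $u$, and let $\eta$ be a $(p,q)$-colouring of $G'$ such that $\eta$ is standard on all forbidding paths, $\eta(y_i)=i$ for all $i$, and the restriction of $\eta$ to $V(G)$ equals $\gamma\circ h$. Then there exists a $(p,q)$-colouring $\eta'$ of $G'$ which is standard on all forbidding paths, whose restriction to $V(G)$ equals $\gamma\circ h'$, and such that $\eta$ reconfigures to $\eta'$.
   Context: All arithmetic on colours is mod $p$; $[a,b]$ denotes the cyclic interval $\{a,a+1,\dots,b\}$ mod $p$. A $(p,q)$-colouring of a graph is a map to $\{0,\dots,p-1\}$ with $q\le|c(x)-c(y)|\le p-q$ on every edge; a $k$-colouring is a proper colouring with colours $\{0,\dots,k-1\}$. $\eta$ reconfigures to $\eta'$ if there is a sequence $\eta=\eta_0,\dots,\eta_n=\eta'$ of $(p,q)$-colourings of $G'$ with consecutive ones differing on only one vertex. Let $t$ be the smallest positive integer with $(t+1)q\equiv r\pmod p$, and let $\gamma(0)=0$, $\gamma(i)=iq+r$ for $1\le i\le k-1$. Construction of $G'$: start from $G$; add a disjoint copy of $G_{p,q}$ on vertices $y_0,\dots,y_{p-1}$ (with $y_iy_j$ an edge iff $q\le|i-j|\le p-q$). For each edge $uv$ of $G$ and each of its two orderings $(u,v)$, add a forbidding path $P_{uv}=u\,x_0^{uv}\cdots x_t^{uv}\,v$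 with new internal vertices (all such paths internally disjoint from each other and from $V(G)\cup\{y_i\}$); join $x_0^{uv}$ and $x_t^{uv}$ to every $y_j$ with $j\in[3q-1,p-q-1]$, and join $x_i^{uv}$ ($1\le i\le t-1$) to every $y_j$ with $j\in[(i+3)q-1,(i-1)q]$. A colouring $\eta$ of $G'$ whose values on $V(G)$ lie in $\gamma(\{0,\dots,k-1\})$ is standard on all forbidding paths if for every ordered pair $(u,v)$ with $uv\in E(G)$: if $\eta(u)=0$ then $\eta(x_i^{uv})=(i+1)q$ for $0\le i\le t$; if $\eta(v)=0$ then $\eta(x_i^{uv})=iq$ for $0\le i\le t-1$ and $\eta(x_t^{uv})=q$; and if $\eta(u)\ne0\ne\eta(v)$ then $\eta(x_i^{uv})=iq$ for $0\le i\le t-1$ and $\eta(x_t^{uv})=0$. -}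

module Defs where

open import Data.Nat using (ℕ; zero; suc; _+_; _*_; _∸_; _≤_; _<_; NonZero; ∣_-_∣)
open import Data.Nat.DivMod using (_%_; _/_)
open import Data.Fin using (Fin; toℕ; fromℕ; inject₁) renaming (zero to fzero; suc to fsuc)
open import Data.Bool using (Bool; true; false; T)
open import Data.Product using (Σ; _×_; _,_)
open import Data.Sum using (_⊎_)
open import Relation.Binary.PropositionalEquality using (_≡_)
open import Relation.Nullary using (¬_)

record Graph : Set where
  field
    n      : ℕ
    adj    : Fin n → Fin n → Bool
    sym    : ∀ u v → adj u v ≡ adj v u
    irrefl : ∀ u → adj u u ≡ false
open Graph public

Edge : (G : Graph) → Fin (n G) → Fin (n G) → Set
Edge G u v = T (adj G u v)

IsKColouring : (G : Graph) (k : ℕ) → (Fin (n G) → Fin k) → Set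
IsKColouring G k h = ∀ u v → Edge G u v → ¬ (h u ≡ h v)

-- Cyclic interval [a,b] mod p: j ∈ [a,b] iff the offset of j from a is at
-- most the offset of b from a (offsets taken in {0,…,p-1}).
InCyc : (p : ℕ) .{{_ : NonZero p}} → ℕ → ℕ → ℕ → Set
InCyc p a b j = ((j + (p ∸ a % p)) % p) ≤ ((b % p + (p ∸ a % p)) % p)

FarApart : (p q : ℕ) → Fin p → Fin p → Set
FarApart p q a b = (q ≤ ∣ toℕ a - toℕ b ∣) × (∣ toℕ a - toℕ b ∣ ≤ p ∸ q)

-- Vertices of G': old vertices of G, y_0..y_{p-1}, and the internal vertices
-- x_0^{uv},…,x_t^{uv} of the forbidding path for each ordered edge (u,v).
data V' (G : Graph) (p t : ℕ) : Set where
  old : Fin (n G) → V' G p t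
  yv  : Fin p → V' G p t
  xv  : (u v : Fin (n G)) → Edge G u v → Fin (suc t) → V' G p t

data Gen (G : Graph) (p q t : ℕ) .{{_ : NonZero p}} : V' G p t → V' G p t → Set where
  e-old  : ∀ {u v} → Edge G u v → Gen G p q t (old u) (old v)
  e-y    : ∀ {i j} → q ≤ ∣ toℕ i - toℕ j ∣ → ∣ toℕ i - toℕ j ∣ ≤ p ∸ q →
           Gen G p q t (yv i) (yv j)
  e-u    : ∀ {u v} (e : Edge G u v) → Gen G p q t (old u) (xv u v e fzero)
  e-path : ∀ {u v} (e : Edge G u v) (i : Fin t) →
           Gen G p q t (xv u v e (inject₁ i)) (xv u v e (fsuc i))
  e-v    : ∀ {u v} (e : Edge G u v) → Gen G p q t (xv u v e (fromℕ t)) (old v)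
  e-y0   : ∀ {u v} (e : Edge G u v) {j : Fin p} →
           InCyc p (3 * q ∸ 1) (p ∸ q ∸ 1) (toℕ j) →
           Gen G p q t (xv u v e fzero) (yv j)
  e-yt   : ∀ {u v} (e : Edge G u v) {j : Fin p} →
           InCyc p (3 * q ∸ 1) (p ∸ q ∸ 1) (toℕ j) →
           Gen G p q t (xv u v e (fromℕ t)) (yv j)
  e-yi   : ∀ {u v} (e : Edge G u v) (i : Fin (suc t)) {j : Fin p} →
           1 ≤ toℕ i → toℕ i ≤ t ∸ 1 →
           InCyc p ((toℕ i + 3) * q ∸ 1) ((toℕ i ∸ 1) * q) (toℕ j) →
           Gen G p q t (xv u v e i) (yv j)

Adj' : (G : Graph) (p q t : ℕ) .{{_ : NonZero p}} → V' G p t → V' G p t → Set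
Adj' G p q t a b = Gen G p q t a b ⊎ Gen G p q t b a

IsPQColouring : (G : Graph) (p q t : ℕ) .{{_ : NonZero p}} → (V' G p t → Fin p) → Set
IsPQColouring G p q t η = ∀ a b → Adj' G p q t a b → FarApart p q (η a) (η b)

Standard : (G : Graph) (p q t : ℕ) .{{_ : NonZero p}} → (V' G p t → Fin p) → Set
Standard G p q t η = ∀ u v (e : Edge G u v) →
  (toℕ (η (old u)) ≡ 0 →
     ∀ (i : Fin (suc t)) → toℕ (η (xv u v e i)) ≡ ((toℕ i + 1) * q) % p)
  × (toℕ (η (old v)) ≡ 0 →
     (∀ (i : Fin (suc t)) → toℕ i < t → toℕ (η (xv u v e i)) ≡ (toℕ i * q) % p)
     × toℕ (η (xv u v e (fromℕ t))) ≡ q % p)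
  × (¬ (toℕ (η (old u)) ≡ 0) → ¬ (toℕ (η (old v)) ≡ 0) →
     (∀ (i : Fin (suc t)) → toℕ i < t → toℕ (η (xv u v e i)) ≡ (toℕ i * q) % p)
     × toℕ (η (xv u v e (fromℕ t))) ≡ 0)

DifferOnOne : {A B : Set} → (A → B) → (A → B) → Set
DifferOnOne {A} η η' = Σ A λ w → ∀ z → ¬ (z ≡ w) → η z ≡ η' z

data Reconf (G : Graph) (p q t : ℕ) .{{_ : NonZero p}} :
     (V' G p t → Fin p) → (V' G p t → Fin p) → Set where
  done : ∀ {η} → Reconf G p q t η η
  step : ∀ {η η₁ η₂} → IsPQColouring G p q t η₁ → DifferOnOne η η₁ →
         Reconf G p q t η₁ η₂ → Reconf G p q t η η₂

IsT : (p q r t : ℕ) .{{_ : NonZero p}} → Set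
IsT p q r t = (1 ≤ t) × (((t + 1) * q) % p ≡ r % p)
  × (∀ s → 1 ≤ s → ((s + 1) * q) % p ≡ r % p → t ≤ s)

γ : (q r : ℕ) → ℕ → ℕ
γ q r zero = 0
γ q r (suc i) = suc i * q + r

module Submission where

-- Only u and the forbidding paths at u have to change.  If neither h u nor
-- h' u is 0, those paths are already in their nonzero standard form, which
-- tolerates any nonzero colour at u, and u is recoloured in a single step.
-- Otherwise, reversing the sequence if necessary, u goes from 0 to γ b with
-- b ≥ 1.  The paths at u are then moved through a short list of colour
-- profiles, switching the neighbours of u one at a time; each intermediate
-- colouring is valid because every edge at u or on its paths joins colours at
-- circular distance at least q, which reduces to explicit congruences mod
-- p = kq + r, the key one being (t + 1)q ≡ r.  For b ≥ 2 the vertex u can jump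
-- directly to γ b; for b = 1 it has to pass through q − 1.

open import Defs hiding (sym)
open import Data.Nat
open import Data.Nat.Properties
open import Data.Nat.DivMod
open import Data.Nat.Tactic.RingSolver using (solve-∀)
open import Data.Fin using (Fin; toℕ; fromℕ; fromℕ<) renaming (_≟_ to _≟ᶠ_; zero to fzero)
open import Data.Fin.Properties using (toℕ-fromℕ<; toℕ<n; toℕ-fromℕ; toℕ-inject₁; toℕ-injective)
open import Data.Product
open import Data.Sum using (_⊎_; inj₁; inj₂)
open import Data.Bool using (true; false; T; if_then_else_)
open import Data.Bool.Properties using (T-irrelevant)
open import Data.Empty
open import Function using (_∘_)
open import Relation.Binary.PropositionalEquality
open import Relation.Binary.Definitions using (tri<; tri≈; tri>)
open import Relation.Nullary
open import Relation.Nullary.Decidable using (T?)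

swap-middle : ∀ a b c → a + b + c ≡ a + c + b
swap-middle = solve-∀

module Congruence (p : ℕ) .{{_ : NonZero p}} where

  -- Congruence mod p phrased without _%_ or subtraction, so that it can be
  -- cancelled and transported along sums freely.
  infix 4 _≋_
  _≋_ : ℕ → ℕ → Set
  a ≋ b = Σ ℕ λ m → Σ ℕ λ n → a + m * p ≡ b + n * p

  ≡⇒≋ : ∀ {a b} → a ≡ b → a ≋ b
  ≡⇒≋ {a} refl = 0 , 0 , refl

  ≋-refl : ∀ {a} → a ≋ a
  ≋-refl = ≡⇒≋ refl

  ≋-sym : ∀ {a b} → a ≋ b → b ≋ a
  ≋-sym (m , n , e) = n , m , sym e

  ≋-trans : ∀ {a b c} → a ≋ b → b ≋ c → a ≋ c
  ≋-trans {a} {b} {c} (m , n , e) (m' , n' , e') = m + m' , n' + n , (begin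
      a + (m + m') * p      ≡⟨ cong (a +_) (*-distribʳ-+ p m m') ⟩
      a + (m * p + m' * p)  ≡⟨ +-assoc a _ _ ⟨
      a + m * p + m' * p    ≡⟨ cong (_+ m' * p) e ⟩
      b + n * p + m' * p    ≡⟨ +-assoc b _ _ ⟩
      b + (n * p + m' * p)  ≡⟨ cong (b +_) (+-comm (n * p) _) ⟩
      b + (m' * p + n * p)  ≡⟨ +-assoc b _ _ ⟨
      b + m' * p + n * p    ≡⟨ cong (_+ n * p) e' ⟩
      c + n' * p + n * p    ≡⟨ +-assoc c _ _ ⟩
      c + (n' * p + n * p)  ≡⟨ cong (c +_) (*-distribʳ-+ p n' n) ⟨
      c + (n' + n) * p      ∎)
    where open ≡-Reasoning

  ≋-+ʳ : ∀ {a b} c → a ≋ b → a + c ≋ b + c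
  ≋-+ʳ {a} {b} c (m , n , e) = m , n , (begin
      a + c + m * p  ≡⟨ swap-middle a c _ ⟩
      a + m * p + c  ≡⟨ cong (_+ c) e ⟩
      b + n * p + c  ≡⟨ swap-middle b _ c ⟩
      b + c + n * p  ∎)
    where open ≡-Reasoning

  ≋-+ˡ : ∀ {a b} c → a ≋ b → c + a ≋ c + b
  ≋-+ˡ {a} {b} c x = ≋-trans (≡⇒≋ (+-comm c a)) (≋-trans (≋-+ʳ c x) (≡⇒≋ (+-comm b c)))

  ≋-cancelʳ : ∀ {a b} c → a + c ≋ b + c → a ≋ b
  ≋-cancelʳ {a} {b} c (m , n , e) = m , n , +-cancelʳ-≡ c _ _ (begin
      a + m * p + c  ≡⟨ swap-middle a _ c ⟩
      a + c + m * p  ≡⟨ e ⟩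
      b + c + n * p  ≡⟨ swap-middle b c _ ⟩
      b + n * p + c  ∎)
    where open ≡-Reasoning

  m+p≋m : ∀ m → m + p ≋ m
  m+p≋m m = 0 , 1 , trans (+-identityʳ _) (cong (m +_) (sym (+-identityʳ p)))

  ≡+p⇒≋ : ∀ {a b} → a ≡ b + p → a ≋ b
  ≡+p⇒≋ {b = b} a≡b+p = ≋-trans (≡⇒≋ a≡b+p) (m+p≋m b)

  p≋0 : p ≋ 0
  p≋0 = m+p≋m 0

  %⇒≋ : ∀ {a b} → a % p ≡ b % p → a ≋ b
  %⇒≋ {a} {b} e = b / p , a / p , (begin
      a + b / p * p                  ≡⟨ cong (_+ b / p * p) (m≡m%n+[m/n]*n a p) ⟩
      a % p + a / p * p + b / p * p  ≡⟨ cong (λ z → z + a / p * p + b / p * p) e ⟩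
      b % p + a / p * p + b / p * p  ≡⟨ swap-middle (b % p) _ _ ⟩
      b % p + b / p * p + a / p * p  ≡⟨ cong (_+ a / p * p) (m≡m%n+[m/n]*n b p) ⟨
      b + a / p * p                  ∎)
    where open ≡-Reasoning

  ≋⇒% : ∀ {a b} → a ≋ b → a % p ≡ b % p
  ≋⇒% {a} {b} (m , n , e) =
    trans (sym ([m+kn]%n≡m%n a m p)) (trans (cong (_% p) e) ([m+kn]%n≡m%n b n p))

  m%p≋m : ∀ m → m % p ≋ m
  m%p≋m m = %⇒≋ (m%n%n≡m%n m p)

  ≋⇒≡ : ∀ {a b} → a ≋ b → a < p → b < p → a ≡ b
  ≋⇒≡ {a} {b} e a<p b<p = trans (sym (m<n⇒m%n≡m a<p)) (trans (≋⇒% e) (m<n⇒m%n≡m b<p))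

module Separation (p : ℕ) .{{_ : NonZero p}} (q : ℕ) where
  open Congruence p

  record Far (x y : ℕ) : Set where
    constructor far
    field
      gap     : ℕ
      q≤gap   : q ≤ gap
      gap+q≤p : gap + q ≤ p
      y+gap≋x : y + gap ≋ x

  far-sym : ∀ {x y} → Far x y → Far y x
  far-sym {x} {y} (far d q≤d d+q≤p y+d≋x) = far (p ∸ d) q≤p∸d p∸d+q≤p x+p∸d≋y
    where
      d≤p : d ≤ p
      d≤p = ≤-trans (m≤m+n d q) d+q≤p
      q≤p∸d : q ≤ p ∸ d
      q≤p∸d = subst (_≤ p ∸ d) (m+n∸m≡n d q) (∸-monoˡ-≤ d d+q≤p)
      p∸d+q≤p : p ∸ d + q ≤ p
      p∸d+q≤p = ≤-trans (+-monoʳ-≤ (p ∸ d) q≤d) (≤-reflexive (m∸n+n≡m d≤p))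
      x+p∸d≋y : x + (p ∸ d) ≋ y
      x+p∸d≋y = ≋-trans (≋-+ʳ (p ∸ d) (≋-sym y+d≋x))
        (≋-trans (≡⇒≋ (trans (+-assoc y d _) (cong (y +_) (m+[n∸m]≡n d≤p)))) (m+p≋m y))

  Far⇒FarApart : ∀ {x y} → Far x y → (a b : Fin p) → toℕ a ≡ x % p → toℕ b ≡ y % p →
                 FarApart p q a b
  Far⇒FarApart {x} {y} (far d q≤d d+q≤p y+d≋x) a b a≡x b≡y = by-cases (toℕ b + d <? p)
    where
      InRange : ℕ → Set
      InRange z = q ≤ z × z ≤ p ∸ q
      d≤p : d ≤ p
      d≤p = ≤-trans (m≤m+n d q) d+q≤p
      d≤p∸q : d ≤ p ∸ q
      d≤p∸q = subst (_≤ p ∸ q) (m+n∸n≡m d q) (∸-monoˡ-≤ q d+q≤p)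
      q≤p∸d : q ≤ p ∸ d
      q≤p∸d = subst (_≤ p ∸ d) (m+n∸m≡n d q) (∸-monoˡ-≤ d d+q≤p)
      b+d≋a : toℕ b + d ≋ toℕ a
      b+d≋a = ≋-trans (≋-+ʳ d (≋-trans (≡⇒≋ b≡y) (m%p≋m y)))
                (≋-trans y+d≋x (≋-sym (≋-trans (≡⇒≋ a≡x) (m%p≋m x))))
      by-cases : Dec (toℕ b + d < p) → FarApart p q a b
      by-cases (yes b+d<p) = subst InRange (sym ∣a-b∣≡d) (q≤d , d≤p∸q)
        where
          a≡b+d : toℕ a ≡ toℕ b + d
          a≡b+d = ≋⇒≡ (≋-sym b+d≋a) (toℕ<n a) b+d<p
          ∣a-b∣≡d : ∣ toℕ a - toℕ b ∣ ≡ d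
          ∣a-b∣≡d = begin
            ∣ toℕ a - toℕ b ∣      ≡⟨ cong (∣_- toℕ b ∣) (trans a≡b+d (+-comm (toℕ b) d)) ⟩
            ∣ d + toℕ b - toℕ b ∣  ≡⟨ m≤n⇒∣n-m∣≡n∸m (m≤n+m (toℕ b) d) ⟩
            d + toℕ b ∸ toℕ b      ≡⟨ m+n∸n≡m d (toℕ b) ⟩
            d                      ∎
            where open ≡-Reasoning
      by-cases (no b+d≮p) = subst InRange (sym ∣a-b∣≡p∸d) (q≤p∸d , ∸-monoʳ-≤ p q≤d)
        where
          E = toℕ b + d ∸ p
          E+p≡b+d : E + p ≡ toℕ b + d
          E+p≡b+d = m∸n+n≡m (≮⇒≥ b+d≮p)
          E<p : E < p
          E<p = +-cancelʳ-< p E p (subst (_< p + p) (sym E+p≡b+d) (+-mono-<-≤ (toℕ<n b) d≤p))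
          a≡E : toℕ a ≡ E
          a≡E = ≋⇒≡ (≋-trans (≋-sym b+d≋a) (≋-trans (≡⇒≋ (sym E+p≡b+d)) (m+p≋m E))) (toℕ<n a) E<p
          E+p∸d≡b : E + (p ∸ d) ≡ toℕ b
          E+p∸d≡b = +-cancelʳ-≡ d _ _ (begin
            E + (p ∸ d) + d  ≡⟨ +-assoc E _ d ⟩
            E + (p ∸ d + d)  ≡⟨ cong (E +_) (m∸n+n≡m d≤p) ⟩
            E + p            ≡⟨ E+p≡b+d ⟩
            toℕ b + d        ∎)
            where open ≡-Reasoning
          ∣a-b∣≡p∸d : ∣ toℕ a - toℕ b ∣ ≡ p ∸ d
          ∣a-b∣≡p∸d = trans (cong (∣_- toℕ b ∣) a≡E)
            (trans (cong (∣ E -_∣) (sym E+p∸d≡b)) (∣m-m+n∣≡n E (p ∸ d)))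

  -- Every j in the cyclic interval [A, B] lies at distance at least e and at
  -- most L + e below x, where L is the length of the interval.
  far-from-interval : ∀ {A B j} → InCyc p A B j → (L e x : ℕ) → A + L ≋ B → L < p →
                      B + e ≋ x → q ≤ e → L + e + q ≤ p → Far x j
  far-from-interval {A} {B} {j} j∈[A,B] L e x A+L≋B L<p B+e≋x q≤e bound =
    far d (≤-trans q≤e (m≤n+m e (L ∸ offj)))
      (≤-trans (+-monoˡ-≤ q (+-monoˡ-≤ e (m∸n≤m L offj))) bound)
      (≋-cancelʳ offj (≋-trans (≡⇒≋ j+d+offj≡j+L+e) (≋-sym x+offj≋j+L+e)))
    where
      o = p ∸ A % p
      offj = (j + o) % p
      A+o≋0 : A + o ≋ 0
      A+o≋0 = ≋-trans (≋-+ʳ o (≋-sym (m%p≋m A))) (≋-trans (≡⇒≋ (m+[n∸m]≡n (m%n≤n A p))) p≋0)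
      offB≋L : (B % p + o) % p ≋ L
      offB≋L = ≋-trans (m%p≋m _) (≋-trans (≋-+ʳ o (m%p≋m B)) (≋-trans (≋-+ʳ o (≋-sym A+L≋B))
                 (≋-trans (≡⇒≋ (trans (swap-middle A L o) (+-comm (A + o) L)))
                 (≋-trans (≋-+ˡ L A+o≋0) (≡⇒≋ (+-identityʳ L))))))
      offj≤L : offj ≤ L
      offj≤L = subst (offj ≤_) (≋⇒≡ offB≋L (m%n<n _ p) L<p) j∈[A,B]
      d = L ∸ offj + e
      j+d+offj≡j+L+e : j + d + offj ≡ j + L + e
      j+d+offj≡j+L+e = begin
        j + (L ∸ offj + e) + offj  ≡⟨ cong (_+ offj) (+-assoc j _ e) ⟨
        j + (L ∸ offj) + e + offj  ≡⟨ swap-middle (j + (L ∸ offj)) e offj ⟩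
        j + (L ∸ offj) + offj + e  ≡⟨ cong (_+ e) (+-assoc j _ offj) ⟩
        j + (L ∸ offj + offj) + e  ≡⟨ cong (λ z → j + z + e) (m∸n+n≡m offj≤L) ⟩
        j + L + e                  ∎
        where open ≡-Reasoning
      rearrange : ∀ A L e j o → A + L + e + (j + o) ≡ (A + o) + (j + L + e)
      rearrange = solve-∀
      x+offj≋j+L+e : x + offj ≋ j + L + e
      x+offj≋j+L+e = ≋-trans (≋-+ʳ offj (≋-sym B+e≋x)) (≋-trans (≋-+ˡ (B + e) (m%p≋m (j + o)))
        (≋-trans (≋-+ʳ (j + o) (≋-+ʳ e (≋-sym A+L≋B)))
        (≋-trans (≡⇒≋ (rearrange A L e j o)) (≋-+ʳ (j + L + e) A+o≋0))))

<ᵇ-true : ∀ {m n} → m < n → (m <ᵇ n) ≡ true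
<ᵇ-true {m} {n} m<n with m <ᵇ n in eq
... | true = refl
... | false = ⊥-elim (subst T eq (<⇒<ᵇ m<n))

<ᵇ-false : ∀ {m n} → ¬ m < n → (m <ᵇ n) ≡ false
<ᵇ-false {m} {n} m≮n with m <ᵇ n in eq
... | false = refl
... | true = ⊥-elim (m≮n (<ᵇ⇒< m n (subst T (sym eq) _)))

≡ᵇ-true : ∀ {m n} → m ≡ n → (m ≡ᵇ n) ≡ true
≡ᵇ-true {m} {n} m≡n with m ≡ᵇ n in eq
... | true = refl
... | false = ⊥-elim (subst T eq (≡⇒≡ᵇ m n m≡n))

≡ᵇ-false : ∀ {m n} → ¬ m ≡ n → (m ≡ᵇ n) ≡ false
≡ᵇ-false {m} {n} m≢n with m ≡ᵇ n in eq
... | false = refl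
... | true = ⊥-elim (m≢n (≡ᵇ⇒≡ m n (subst T (sym eq) _)))

module _ {A : Set} {x y : A} {m n : ℕ} where

  if-< : m < n → (if m <ᵇ n then x else y) ≡ x
  if-< m<n = cong (if_then x else y) (<ᵇ-true m<n)

  if-≮ : ¬ m < n → (if m <ᵇ n then x else y) ≡ y
  if-≮ m≮n = cong (if_then x else y) (<ᵇ-false m≮n)

  if-≡ : m ≡ n → (if m ≡ᵇ n then x else y) ≡ x
  if-≡ m≡n = cong (if_then x else y) (≡ᵇ-true m≡n)

  if-≢ : ¬ m ≡ n → (if m ≡ᵇ n then x else y) ≡ y
  if-≢ m≢n = cong (if_then x else y) (≡ᵇ-false m≢n)

if-<-suc : ∀ {A : Set} {x y : A} {m n} → ¬ m ≡ n → (if m <ᵇ n then x else y) ≡ (if m <ᵇ suc n then x else y)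
if-<-suc {m = m} {n} m≢n with m <? n
... | yes m<n = trans (if-< m<n) (sym (if-< (m<n⇒m<1+n m<n)))
... | no m≮n = trans (if-≮ m≮n) (sym (if-≮ λ m<1+n → m≢n (≤-antisym (s≤s⁻¹ m<1+n) (≮⇒≥ m≮n))))

module EdgeFacts (G : Graph) where

  Edge-sym : ∀ {a b} → Edge G a b → Edge G b a
  Edge-sym {a} {b} = subst T (Graph.sym G a b)

  Edge-irrefl : ∀ {a} → ¬ Edge G a a
  Edge-irrefl {a} = subst T (Graph.irrefl G a)

FarApart-sym : ∀ {p q} (a b : Fin p) → FarApart p q a b → FarApart p q b a
FarApart-sym {p} {q} a b = subst (λ z → q ≤ z × z ≤ p ∸ q) (∣-∣-comm (toℕ a) (toℕ b))

module Reconfiguration (G : Graph) (p q t : ℕ) .{{_ : NonZero p}} where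

  infixr 5 _++_
  _++_ : ∀ {a b c} → Reconf G p q t a b → Reconf G p q t b c → Reconf G p q t a c
  done ++ r = r
  step v d r₁ ++ r = step v d (r₁ ++ r)

  one-step : ∀ {a b} → IsPQColouring G p q t b → DifferOnOne a b → Reconf G p q t a b
  one-step v d = step v d done

  reverse : ∀ {a b} → IsPQColouring G p q t a → Reconf G p q t a b → Reconf G p q t b a
  reverse va done = done
  reverse va (step v₁ (w , f) r) = reverse v₁ r ++ one-step va (w , λ z z≢w → sym (f z z≢w))

  -- Without function extensionality, pointwise equal colourings are joined by
  -- a step "recolouring" an arbitrary vertex.
  ≗⇒Reconf : ∀ {a b} → V' G p t → IsPQColouring G p q t b → (∀ z → a z ≡ b z) → Reconf G p q t a b
  ≗⇒Reconf w vb a≗b = one-step vb (w , λ z _ → a≗b z)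

  chain-up : (F : ℕ → V' G p t → Fin p) → ∀ k → (∀ m → m < k → Reconf G p q t (F m) (F (suc m))) →
             Reconf G p q t (F 0) (F k)
  chain-up F zero f = done
  chain-up F (suc k) f = chain-up F k (λ m m<k → f m (m<n⇒m<1+n m<k)) ++ f k ≤-refl

  chain-down : (F : ℕ → V' G p t → Fin p) → ∀ k → (∀ m → m < k → Reconf G p q t (F (suc m)) (F m)) →
               Reconf G p q t (F k) (F 0)
  chain-down F zero f = done
  chain-down F (suc k) f = f k ≤-refl ++ chain-down F k (λ m m<k → f m (m<n⇒m<1+n m<k))

module PathConditions (p : ℕ) .{{_ : NonZero p}} (q t : ℕ) where
  open Separation p q

  JoinedToEnds : ℕ → Set
  JoinedToEnds j = InCyc p (3 * q ∸ 1) (p ∸ q ∸ 1) j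

  JoinedToInner : ℕ → ℕ → Set
  JoinedToInner i j = InCyc p ((i + 3) * q ∸ 1) ((i ∸ 1) * q) j

  -- A i is the colour of x_i on a forbidding path from the centre to a vertex
  -- of colour C; for InPathOK the path runs from that vertex to the centre.
  record OutPathOK (A : ℕ → ℕ) (C : ℕ) : Set where
    field
      out-end     : Far (A t) C
      out-steps   : ∀ i → i < t → Far (A i) (A (suc i))
      out-first-y : ∀ j → JoinedToEnds j → Far (A 0) j
      out-last-y  : ∀ j → JoinedToEnds j → Far (A t) j
      out-inner-y : ∀ i j → 1 ≤ i → i ≤ t ∸ 1 → JoinedToInner i j → Far (A i) j

  record InPathOK (W : ℕ → ℕ) (C : ℕ) : Set where
    field
      in-end     : Far C (W 0)
      in-steps   : ∀ i → i < t → Far (W i) (W (suc i))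
      in-first-y : ∀ j → JoinedToEnds j → Far (W 0) j
      in-last-y  : ∀ j → JoinedToEnds j → Far (W t) j
      in-inner-y : ∀ i j → 1 ≤ i → i ≤ t ∸ 1 → JoinedToInner i j → Far (W i) j

  record PathState : Set where
    constructor paths
    field
      outward inward : ℕ → ℕ

  record Compatible (U : ℕ) (s : PathState) (C : ℕ) : Set where
    constructor compatible
    field
      centre-end : Far U C
      centre-out : Far U (PathState.outward s 0)
      centre-in  : Far U (PathState.inward s t)
      out-ok     : OutPathOK (PathState.outward s) C
      in-ok      : InPathOK (PathState.inward s) C

  open OutPathOK public
  open InPathOK public
  open PathState public
  open Compatible public

module Repaint (G : Graph) (p q t : ℕ) .{{_ : NonZero p}} (u : Fin (n G)) (η : V' G p t → Fin p)
               (η-valid : IsPQColouring G p q t η) (η-y : ∀ i → η (yv i) ≡ i) where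
  open Separation p q
  open PathConditions p q t
  open Reconfiguration G p q t
  open EdgeFacts G

  repaint : ℕ → (Fin (n G) → PathState) → V' G p t → Fin p
  repaint U σ (old v) with v ≟ᶠ u
  ... | yes _ = U mod p
  ... | no _ = η (old v)
  repaint U σ (yv i) = η (yv i)
  repaint U σ (xv a b e i) with a ≟ᶠ u | b ≟ᶠ u
  ... | yes _ | _ = outward (σ b) (toℕ i) mod p
  ... | no _ | yes _ = inward (σ a) (toℕ i) mod p
  ... | no _ | no _ = η (xv a b e i)

  CompatibleAround : ℕ → (Fin (n G) → PathState) → Set
  CompatibleAround U σ = ∀ w → Edge G u w → Σ ℕ λ C → toℕ (η (old w)) ≡ C % p × Compatible U (σ w) C

  compatible-at : ∀ {U σ} (nb : CompatibleAround U σ) w (e : Edge G u w) →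
                  Compatible U (σ w) (proj₁ (nb w e))
  compatible-at nb w e = proj₂ (proj₂ (nb w e))

  toℕ-mod : ∀ x → toℕ (x mod p) ≡ x % p
  toℕ-mod x = toℕ-fromℕ< (m%n<n x p)

  toℕ-mod-cong : ∀ (f : ℕ → ℕ) {i j} → i ≡ j → toℕ (f i mod p) ≡ f j % p
  toℕ-mod-cong f refl = toℕ-mod (f _)

  farApart : ∀ {x y} {a b : Fin p} → Far x y → toℕ a ≡ x % p → toℕ b ≡ y % p → FarApart p q a b
  farApart f a≡x b≡y = Far⇒FarApart f _ _ a≡x b≡y

  toℕ-η-y : ∀ j → toℕ (η (yv j)) ≡ toℕ j % p
  toℕ-η-y j = trans (cong toℕ (η-y j)) (sym (m<n⇒m%n≡m (toℕ<n j)))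

  repaint-gen : ∀ {U σ} → CompatibleAround U σ → ∀ {a b} → Gen G p q t a b →
                FarApart p q (repaint U σ a) (repaint U σ b)
  repaint-gen {U} {σ} nb (e-old {a} {b} e) with a ≟ᶠ u | b ≟ᶠ u
  ... | yes refl | yes refl = ⊥-elim (Edge-irrefl e)
  ... | yes refl | no _ = let (C , ηw≡C , c) = nb b e in
                          farApart (centre-end c) (toℕ-mod U) ηw≡C
  ... | no _ | yes refl = let (C , ηw≡C , c) = nb a (Edge-sym e) in
                          farApart (far-sym (centre-end c)) ηw≡C (toℕ-mod U)
  ... | no _ | no _ = η-valid _ _ (inj₁ (e-old e))
  repaint-gen nb (e-y x y) = η-valid _ _ (inj₁ (e-y x y))
  repaint-gen {U} {σ} nb (e-u {a} {b} e) with a ≟ᶠ u | b ≟ᶠ u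
  ... | yes refl | _ = farApart (centre-out (compatible-at nb b e)) (toℕ-mod U) (toℕ-mod _)
  ... | no _ | yes refl = let (C , ηw≡C , c) = nb a (Edge-sym e) in
                          farApart (in-end (in-ok c)) ηw≡C (toℕ-mod _)
  ... | no _ | no _ = η-valid _ _ (inj₁ (e-u e))
  repaint-gen {U} {σ} nb (e-path {a} {b} e i) with a ≟ᶠ u | b ≟ᶠ u
  ... | yes refl | _ = farApart (out-steps (out-ok (compatible-at nb b e)) (toℕ i) (toℕ<n i))
                         (toℕ-mod-cong (outward (σ b)) (toℕ-inject₁ i)) (toℕ-mod _)
  ... | no _ | yes refl = farApart (in-steps (in-ok (compatible-at nb a (Edge-sym e))) (toℕ i) (toℕ<n i))
                         (toℕ-mod-cong (inward (σ a)) (toℕ-inject₁ i)) (toℕ-mod _)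
  ... | no _ | no _ = η-valid _ _ (inj₁ (e-path e i))
  repaint-gen {U} {σ} nb (e-v {a} {b} e) with a ≟ᶠ u | b ≟ᶠ u
  ... | yes refl | yes refl = ⊥-elim (Edge-irrefl e)
  ... | yes refl | no _ = let (C , ηw≡C , c) = nb b e in
                          farApart (out-end (out-ok c)) (toℕ-mod-cong (outward (σ b)) (toℕ-fromℕ t)) ηw≡C
  ... | no _ | yes refl = farApart (far-sym (centre-in (compatible-at nb a (Edge-sym e))))
                            (toℕ-mod-cong (inward (σ a)) (toℕ-fromℕ t)) (toℕ-mod U)
  ... | no _ | no _ = η-valid _ _ (inj₁ (e-v e))
  repaint-gen {U} {σ} nb (e-y0 {a} {b} e {j} j∈) with a ≟ᶠ u | b ≟ᶠ u
  ... | yes refl | _ = farApart (out-first-y (out-ok (compatible-at nb b e)) (toℕ j) j∈) (toℕ-mod _) (toℕ-η-y j)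
  ... | no _ | yes refl = farApart (in-first-y (in-ok (compatible-at nb a (Edge-sym e))) (toℕ j) j∈)
                            (toℕ-mod _) (toℕ-η-y j)
  ... | no _ | no _ = η-valid _ _ (inj₁ (e-y0 e j∈))
  repaint-gen {U} {σ} nb (e-yt {a} {b} e {j} j∈) with a ≟ᶠ u | b ≟ᶠ u
  ... | yes refl | _ = farApart (out-last-y (out-ok (compatible-at nb b e)) (toℕ j) j∈)
                         (toℕ-mod-cong (outward (σ b)) (toℕ-fromℕ t)) (toℕ-η-y j)
  ... | no _ | yes refl = farApart (in-last-y (in-ok (compatible-at nb a (Edge-sym e))) (toℕ j) j∈)
                            (toℕ-mod-cong (inward (σ a)) (toℕ-fromℕ t)) (toℕ-η-y j)
  ... | no _ | no _ = η-valid _ _ (inj₁ (e-yt e j∈))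
  repaint-gen {U} {σ} nb (e-yi {a} {b} e i {j} 1≤i i≤t∸1 j∈) with a ≟ᶠ u | b ≟ᶠ u
  ... | yes refl | _ = farApart (out-inner-y (out-ok (compatible-at nb b e)) (toℕ i) (toℕ j) 1≤i i≤t∸1 j∈)
                         (toℕ-mod _) (toℕ-η-y j)
  ... | no _ | yes refl = farApart (in-inner-y (in-ok (compatible-at nb a (Edge-sym e))) (toℕ i) (toℕ j) 1≤i i≤t∸1 j∈)
                            (toℕ-mod _) (toℕ-η-y j)
  ... | no _ | no _ = η-valid _ _ (inj₁ (e-yi e i 1≤i i≤t∸1 j∈))

  repaint-valid : ∀ {U σ} → CompatibleAround U σ → IsPQColouring G p q t (repaint U σ)
  repaint-valid nb a b (inj₁ g) = repaint-gen nb g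
  repaint-valid {U} {σ} nb a b (inj₂ g) = FarApart-sym (repaint U σ b) (repaint U σ a) (repaint-gen nb g)

  repaint-≗ : ∀ U {σ σ'} → (∀ w → σ w ≡ σ' w) → ∀ z → repaint U σ z ≡ repaint U σ' z
  repaint-≗ U σ≗σ' (old v) with v ≟ᶠ u
  ... | yes _ = refl
  ... | no _ = refl
  repaint-≗ U σ≗σ' (yv i) = refl
  repaint-≗ U σ≗σ' (xv a b e i) with a ≟ᶠ u | b ≟ᶠ u
  ... | yes _ | _ = cong (λ s → outward s (toℕ i) mod p) (σ≗σ' b)
  ... | no _ | yes _ = cong (λ s → inward s (toℕ i) mod p) (σ≗σ' a)
  ... | no _ | no _ = refl

  repaint-old : ∀ U σ v → ¬ v ≡ u → repaint U σ (old v) ≡ η (old v)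
  repaint-old U σ v v≢u with v ≟ᶠ u
  ... | yes v≡u = ⊥-elim (v≢u v≡u)
  ... | no _ = refl

  repaint-centre : ∀ U σ → toℕ (repaint U σ (old u)) ≡ U % p
  repaint-centre U σ with u ≟ᶠ u
  ... | yes _ = toℕ-mod U
  ... | no u≢u = ⊥-elim (u≢u refl)

  ≡-mod : ∀ {x : Fin p} {m n} → toℕ x ≡ m % p → n ≡ m → x ≡ n mod p
  ≡-mod x≡m n≡m = toℕ-injective (trans x≡m (trans (cong (_% p) (sym n≡m)) (sym (toℕ-mod _))))

  recolour-centre : ∀ U U' σ → CompatibleAround U' σ → Reconf G p q t (repaint U σ) (repaint U' σ)
  recolour-centre U U' σ nb = one-step (repaint-valid nb) (old u , agree)
    where
      agree : ∀ z → ¬ z ≡ old u → repaint U σ z ≡ repaint U' σ z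
      agree (old v) z≢u with v ≟ᶠ u
      ... | yes refl = ⊥-elim (z≢u refl)
      ... | no _ = refl
      agree (yv i) _ = refl
      agree (xv a b e i) _ with a ≟ᶠ u | b ≟ᶠ u
      ... | yes _ | _ = refl
      ... | no _ | yes _ = refl
      ... | no _ | no _ = refl

  data Slot : Set where
    out-slot in-slot : ℕ → Slot

  AgreeOff : Slot → PathState → PathState → Set
  AgreeOff (out-slot m) P P' = (∀ i → i ≤ t → ¬ i ≡ m → outward P i ≡ outward P' i)
                             × (∀ i → i ≤ t → inward P i ≡ inward P' i)
  AgreeOff (in-slot m) P P' = (∀ i → i ≤ t → outward P i ≡ outward P' i)
                            × (∀ i → i ≤ t → ¬ i ≡ m → inward P i ≡ inward P' i)

  mix : PathState → PathState → ℕ → Fin (n G) → PathState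
  mix P P' j w = if toℕ w <ᵇ j then P' else P

  mix-suc : ∀ P P' j w → mix P P' j w ≡ mix P P' (suc j) w
                       ⊎ (toℕ w ≡ j × mix P P' j w ≡ P × mix P P' (suc j) w ≡ P')
  mix-suc P P' j w with toℕ w <? j | toℕ w <? suc j
  ... | yes w<j | _ = inj₁ (trans (if-< w<j) (sym (if-< (m<n⇒m<1+n w<j))))
  ... | no w≮j | no w≮1+j = inj₁ (trans (if-≮ w≮j) (sym (if-≮ w≮1+j)))
  ... | no w≮j | yes w<1+j = inj₂ (≤-antisym (s≤s⁻¹ w<1+j) (≮⇒≥ w≮j) , if-≮ w≮j , if-< w<1+j)

  slot-index : ℕ → Fin (suc t)
  slot-index m with m <? suc t
  ... | yes m<1+t = fromℕ< m<1+t
  ... | no _ = fzero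

  slot-index-toℕ : ∀ (i : Fin (suc t)) → slot-index (toℕ i) ≡ i
  slot-index-toℕ i with toℕ i <? suc t
  ... | yes i<1+t = toℕ-injective (toℕ-fromℕ< i<1+t)
  ... | no i≮1+t = ⊥-elim (i≮1+t (toℕ<n i))

  -- The vertex in slot sl of the forbidding path between u and the vertex of
  -- index j; an arbitrary vertex when there is no such path.
  slot-vertex : Slot → ℕ → V' G p t
  slot-vertex sl j with j <? n G
  ... | no _ = old u
  ... | yes j<n with T? (adj G u (fromℕ< j<n))
  ...   | no _ = old u
  ...   | yes e with sl
  ...     | out-slot m = xv u (fromℕ< j<n) e (slot-index m)
  ...     | in-slot m = xv (fromℕ< j<n) u (Edge-sym e) (slot-index m)

  xv-cong : ∀ {a a' b b'} (e : Edge G a b) (e' : Edge G a' b') (i : Fin (suc t)) →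
            a ≡ a' → b ≡ b' → xv a b e i ≡ xv a' b' e' i
  xv-cong {a} {b = b} e e' i refl refl = cong (λ z → xv {G} {p} {t} a b z i) (T-irrelevant e e')

  out-vertex-slot : ∀ b (e : Edge G u b) (i : Fin (suc t)) →
                    xv u b e i ≡ slot-vertex (out-slot (toℕ i)) (toℕ b)
  out-vertex-slot b e i with toℕ b <? n G
  ... | no b≮n = ⊥-elim (b≮n (toℕ<n b))
  ... | yes b<n with T? (adj G u (fromℕ< b<n)) | toℕ-injective (toℕ-fromℕ< b<n)
  ...   | no ¬e | b'≡b = ⊥-elim (¬e (subst (Edge G u) (sym b'≡b) e))
  ...   | yes e' | b'≡b = trans (xv-cong e e' i refl (sym b'≡b))
                            (cong (xv u (fromℕ< b<n) e') (sym (slot-index-toℕ i)))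

  in-vertex-slot : ∀ a (e : Edge G a u) (i : Fin (suc t)) →
                   xv a u e i ≡ slot-vertex (in-slot (toℕ i)) (toℕ a)
  in-vertex-slot a e i with toℕ a <? n G
  ... | no a≮n = ⊥-elim (a≮n (toℕ<n a))
  ... | yes a<n with T? (adj G u (fromℕ< a<n)) | toℕ-injective (toℕ-fromℕ< a<n)
  ...   | no ¬e | a'≡a = ⊥-elim (¬e (subst (Edge G u) (sym a'≡a) (Edge-sym e)))
  ...   | yes e' | a'≡a = trans (xv-cong e (Edge-sym e') i (sym a'≡a) refl)
                            (cong (xv (fromℕ< a<n) u (Edge-sym e')) (sym (slot-index-toℕ i)))

  outward-unchanged : ∀ {P P'} sl → AgreeOff sl P P' → ∀ b (e : Edge G u b) i →
              ¬ xv u b e i ≡ slot-vertex sl (toℕ b) → outward P (toℕ i) ≡ outward P' (toℕ i)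
  outward-unchanged (out-slot m) (ag , _) b e i x≢ =
    ag (toℕ i) (s≤s⁻¹ (toℕ<n i)) λ i≡m →
      x≢ (trans (out-vertex-slot b e i) (cong (λ m → slot-vertex (out-slot m) (toℕ b)) i≡m))
  outward-unchanged (in-slot m) (ag , _) b e i _ = ag (toℕ i) (s≤s⁻¹ (toℕ<n i))

  inward-unchanged : ∀ {P P'} sl → AgreeOff sl P P' → ∀ a (e : Edge G a u) i →
             ¬ xv a u e i ≡ slot-vertex sl (toℕ a) → inward P (toℕ i) ≡ inward P' (toℕ i)
  inward-unchanged (in-slot m) (_ , ag) a e i x≢ =
    ag (toℕ i) (s≤s⁻¹ (toℕ<n i)) λ i≡m →
      x≢ (trans (in-vertex-slot a e i) (cong (λ m → slot-vertex (in-slot m) (toℕ a)) i≡m))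
  inward-unchanged (out-slot m) (_ , ag) a e i _ = ag (toℕ i) (s≤s⁻¹ (toℕ<n i))

  mix-step-differs : ∀ U P P' sl → AgreeOff sl P P' → ∀ j →
                     DifferOnOne (repaint U (mix P P' j)) (repaint U (mix P P' (suc j)))
  mix-step-differs U P P' sl agree j = slot-vertex sl j , same
    where
      same : ∀ z → ¬ z ≡ slot-vertex sl j → repaint U (mix P P' j) z ≡ repaint U (mix P P' (suc j)) z
      same (old v) _ with v ≟ᶠ u
      ... | yes _ = refl
      ... | no _ = refl
      same (yv i) _ = refl
      same (xv a b e i) z≢x with a ≟ᶠ u | b ≟ᶠ u
      ... | yes refl | _ with mix-suc P P' j b
      ...   | inj₁ eq = cong (λ s → outward s (toℕ i) mod p) eq
      ...   | inj₂ (b≡j , eq , eq') = cong (_mod p) (begin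
                outward (mix P P' j b) (toℕ i)        ≡⟨ cong (λ s → outward s (toℕ i)) eq ⟩
                outward P (toℕ i)                     ≡⟨ outward-unchanged sl agree b e i
                                                           (λ x≡ → z≢x (trans x≡ (cong (slot-vertex sl) b≡j))) ⟩
                outward P' (toℕ i)                    ≡⟨ cong (λ s → outward s (toℕ i)) eq' ⟨
                outward (mix P P' (suc j) b) (toℕ i)  ∎)
        where open ≡-Reasoning
      same (xv a b e i) z≢x | no _ | yes refl with mix-suc P P' j a
      ...   | inj₁ eq = cong (λ s → inward s (toℕ i) mod p) eq
      ...   | inj₂ (a≡j , eq , eq') = cong (_mod p) (begin
                inward (mix P P' j a) (toℕ i)         ≡⟨ cong (λ s → inward s (toℕ i)) eq ⟩
                inward P (toℕ i)                      ≡⟨ inward-unchanged sl agree a e i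
                                                           (λ x≡ → z≢x (trans x≡ (cong (slot-vertex sl) a≡j))) ⟩
                inward P' (toℕ i)                     ≡⟨ cong (λ s → inward s (toℕ i)) eq' ⟨
                inward (mix P P' (suc j) a) (toℕ i)   ∎)
        where open ≡-Reasoning
      same (xv a b e i) _ | no _ | no _ = refl

  CompatibleAround₂ : ℕ → PathState → PathState → Set
  CompatibleAround₂ U P P' = ∀ w → Edge G u w →
    Σ ℕ λ C → toℕ (η (old w)) ≡ C % p × Compatible U P C × Compatible U P' C

  compatible₂-target : ∀ {U P P'} → CompatibleAround₂ U P P' → CompatibleAround U (λ _ → P')
  compatible₂-target nb w e = let (C , ηw≡C , _ , c') = nb w e in C , ηw≡C , c'

  mix-compatible : ∀ {U P P'} → CompatibleAround₂ U P P' → ∀ j → CompatibleAround U (mix P P' j)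
  mix-compatible nb j w e with toℕ w <ᵇ j | nb w e
  ... | true | C , ηw≡C , _ , c' = C , ηw≡C , c'
  ... | false | C , ηw≡C , c , _ = C , ηw≡C , c

  -- The paths are switched one neighbour at a time, in the order of the
  -- vertex indices; every switch recolours the single vertex in slot sl.
  switch-paths : ∀ U P P' sl → AgreeOff sl P P' → CompatibleAround₂ U P P' →
                 Reconf G p q t (repaint U (λ _ → P)) (repaint U (λ _ → P'))
  switch-paths U P P' sl agree nb =
    ≗⇒Reconf (old u) (repaint-valid (mix-compatible nb 0)) (repaint-≗ U λ _ → refl)
    ++ chain-up (λ j → repaint U (mix P P' j)) (n G)
         (λ j _ → one-step (repaint-valid (mix-compatible nb (suc j))) (mix-step-differs U P P' sl agree j))
    ++ ≗⇒Reconf (old u) (repaint-valid (compatible₂-target nb)) (repaint-≗ U λ w → if-< (toℕ<n w))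

module Normalised (r0 s0 k' t0 : ℕ) where
  r q-1 q p t p-q-1 p-1 : ℕ
  r = suc r0
  q-1 = r + s0
  q = suc q-1
  p = (4 + k') * q + r
  t = suc (suc t0)
  p-q-1 = q-1 + ((2 + k') * q + r)
  p-1 = q-1 + ((3 + k') * q + r)

  mid : ℕ → ℕ
  mid i = suc i * q + q-1

  open Congruence p public
  open Separation p q public
  open PathConditions p q t public

  q-1≤q : q-1 ≤ q
  q-1≤q = n≤1+n q-1
  r<q : r < q
  r<q = s≤s (m≤m+n r s0)
  1+s0≤q : suc s0 ≤ q
  1+s0≤q = s≤s (m≤n+m s0 r)
  q≤2q : q ≤ q + q
  q≤2q = m≤m+n q q
  2q≤3q : q + q ≤ q + q + q
  2q≤3q = m≤m+n (q + q) q
  q≤3q : q ≤ q + q + q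
  q≤3q = ≤-trans q≤2q 2q≤3q
  q+1≤2q : q + 1 ≤ q + q
  q+1≤2q = +-monoʳ-≤ q (s≤s z≤n)

  gap+q≤p : ∀ {d} → d ≤ q + q + q → d + q ≤ p
  gap+q≤p {d} d≤3q =
    ≤-trans (+-monoˡ-≤ q d≤3q) (≤-trans (m≤m+n _ (k' * q + r)) (≤-reflexive (eq q r k')))
    where eq : ∀ q r k' → q + q + q + q + (k' * q + r) ≡ (4 + k') * q + r
          eq = solve-∀

  far-gap : ∀ {x y} d → q ≤ d → d ≤ q + q + q → y + d ≋ x → Far x y
  far-gap d q≤d d≤3q = far d q≤d (gap+q≤p d≤3q)

  far-gap≡ : ∀ {x y} d → q ≤ d → d ≤ q + q + q → y + d ≡ x → Far x y
  far-gap≡ d q≤d d≤3q y+d≡x = far-gap d q≤d d≤3q (≡⇒≋ y+d≡x)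

  far-gap≡+p : ∀ {x y} d → q ≤ d → d ≤ q + q + q → y + d ≡ x + p → Far x y
  far-gap≡+p d q≤d d≤3q y+d≡x+p = far-gap d q≤d d≤3q (≡+p⇒≋ y+d≡x+p)

  far-subst : ∀ {x y x' y'} → x ≡ x' → y ≡ y' → Far x' y' → Far x y
  far-subst refl refl f = f

  far-step : ∀ i → Far (suc i * q) (i * q)
  far-step i = far-gap≡ q ≤-refl q≤3q (+-comm (i * q) q)

  far-step₂ : ∀ i → Far (suc (suc i) * q) (i * q)
  far-step₂ i = far-gap≡ (q + q) q≤2q 2q≤3q (eq i q)
    where eq : ∀ i q → i * q + (q + q) ≡ suc (suc i) * q
          eq = solve-∀

  far-mid-step : ∀ i → Far (mid (suc i)) (mid i)
  far-mid-step i = far-gap≡ q ≤-refl q≤3q (eq i q q-1)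
    where eq : ∀ i q q-1 → suc i * q + q-1 + q ≡ suc (suc i) * q + q-1
          eq = solve-∀

  far-mid-hi : ∀ i → Far (mid (suc i)) (suc i * q)
  far-mid-hi i = far-gap≡ (q + q-1) (m≤m+n q q-1) (≤-trans (+-monoʳ-≤ q q-1≤q) 2q≤3q) (eq i q q-1)
    where eq : ∀ i q q-1 → suc i * q + (q + q-1) ≡ suc (suc i) * q + q-1
          eq = solve-∀

  far-mid-lo : ∀ i → Far (mid (suc i)) (i * q)
  far-mid-lo i = far-gap≡ (q + q + q-1) (≤-trans q≤2q (m≤m+n (q + q) q-1)) (+-monoʳ-≤ (q + q) q-1≤q) (eq i q q-1)
    where eq : ∀ i q q-1 → i * q + (q + q + q-1) ≡ suc (suc i) * q + q-1
          eq = solve-∀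

  γ-room : ∀ {c} → c ≤ 3 + k' → c * q + r + q ≤ p
  γ-room {c} c≤ = ≤-trans (+-monoˡ-≤ q (+-monoˡ-≤ r (*-monoˡ-≤ q c≤))) (≤-reflexive (eq q r k'))
    where eq : ∀ q r k' → (3 + k') * q + r + q ≡ (4 + k') * q + r
          eq = solve-∀

  γ<p : ∀ {c} → c < 4 + k' → γ q r c < p
  γ<p {zero} _ = ≤-trans (s≤s z≤n) (gap+q≤p z≤n)
  γ<p {suc c} c<k = ≤-trans (≤-trans (≤-reflexive (+-comm 1 _)) (+-monoʳ-≤ (suc c * q + r) (s≤s z≤n)))
                            (γ-room (s≤s⁻¹ c<k))

  far-0 : ∀ {x} → q ≤ x → x + q ≤ p → Far x 0
  far-0 {x} q≤x x+q≤p = far x q≤x x+q≤p ≋-refl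

  far-γ-0 : ∀ c → suc c < 4 + k' → Far (suc c * q + r) 0
  far-γ-0 c c<k = far-0 (≤-trans (m≤m+n q (c * q)) (m≤m+n _ r)) (γ-room (s≤s⁻¹ c<k))

  far-0-q : Far 0 q
  far-0-q = far-sym (far-0 ≤-refl (gap+q≤p q≤3q))

  far-0-[2q-1] : Far 0 (q + q-1)
  far-0-[2q-1] = far-sym (far-0 (m≤m+n q q-1) (gap+q≤p (≤-trans (+-monoʳ-≤ q q-1≤q) 2q≤3q)))

  far-[q+r]-0 : Far (q + r) 0
  far-[q+r]-0 = far-0 (m≤m+n q r) (gap+q≤p (≤-trans (+-monoʳ-≤ q (<⇒≤ r<q)) 2q≤3q))

  far-γ-< : ∀ {b c} → b < c → suc c < 4 + k' → Far (suc c * q + r) (suc b * q + r)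
  far-γ-< {b} {c} b<c c<k = far-subst (cong (λ z → suc z * q + r) c≡) refl (far (suc d * q) (m≤m+n q (d * q)) room (≡⇒≋ (eq b d q r)))
    where
      d = c ∸ suc b
      c≡ : c ≡ b + suc d
      c≡ = sym (trans (+-suc b d) (m+[n∸m]≡n b<c))
      room : suc d * q + q ≤ p
      room = ≤-trans (+-monoˡ-≤ q (≤-trans (*-monoˡ-≤ q (subst (suc d ≤_) (cong suc (sym c≡)) (m≤n+m (suc d) (suc b))))
                                             (m≤m+n _ r)))
                     (γ-room (s≤s⁻¹ c<k))
      eq : ∀ b d q r → suc b * q + r + suc d * q ≡ suc (b + suc d) * q + r
      eq = solve-∀

  far-γ-γ : ∀ b c → suc b < 4 + k' → suc c < 4 + k' → ¬ c ≡ b → Far (suc b * q + r) (suc c * q + r)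
  far-γ-γ b c b<k c<k c≢b with <-cmp b c
  ... | tri< b<c _ _ = far-sym (far-γ-< b<c c<k)
  ... | tri≈ _ b≡c _ = ⊥-elim (c≢b (sym b≡c))
  ... | tri> _ _ c<b = far-γ-< c<b b<k

  far-[2q-1]-[q-1] : Far (q + q-1) q-1
  far-[2q-1]-[q-1] = far-gap≡ q ≤-refl q≤3q (+-comm q-1 q)

  far-[p-1]-[q-1] : Far p-1 q-1
  far-[p-1]-[q-1] = far ((3 + k') * q + r) (≤-trans (m≤m+n q _) (m≤m+n _ r)) (γ-room ≤-refl) ≋-refl

  far-γ-[q-1] : ∀ c → suc (suc c) < 4 + k' → Far (suc (suc c) * q + r) q-1
  far-γ-[q-1] c c<k = far gap (≤-trans (m≤m+n q (c * q)) (≤-trans (m≤m+n _ r) (m≤m+n _ 1))) room (≡⇒≋ (eq₁ q-1 c r))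
    where
      gap = suc c * q + r + 1
      eq₁ : ∀ q-1 c r → q-1 + (suc c * suc q-1 + r + 1) ≡ suc (suc c) * suc q-1 + r
      eq₁ = solve-∀
      eq₂ : ∀ q-1 c r → suc c * suc q-1 + r + 1 + q-1 ≡ suc (suc c) * suc q-1 + r
      eq₂ = solve-∀
      room : gap + q ≤ p
      room = ≤-trans (+-monoˡ-≤ q (subst (gap ≤_) (eq₂ q-1 c r) (m≤m+n gap q-1))) (γ-room (s≤s⁻¹ c<k))

  far-[q+r]-[p-1] : Far (q + r) p-1
  far-[q+r]-[p-1] = far-gap≡+p (q + r + 1) (≤-trans (m≤m+n q r) (m≤m+n _ 1))
    (≤-trans (≤-reflexive (+-assoc q r 1)) (≤-trans (+-monoʳ-≤ q (subst (_≤ q) (+-comm 1 r) r<q)) 2q≤3q))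
    (eq q-1 r k')
    where eq : ∀ q-1 r k' → q-1 + ((3 + k') * suc q-1 + r) + (suc q-1 + r + 1) ≡ suc q-1 + r + ((4 + k') * suc q-1 + r)
          eq = solve-∀

  far-γ-[q+r] : ∀ c → suc (suc c) < 4 + k' → Far (suc (suc c) * q + r) (q + r)
  far-γ-[q+r] c c<k = far (suc c * q) (m≤m+n q (c * q)) room (≡⇒≋ (eq c q r))
    where
      room : suc c * q + q ≤ p
      room = ≤-trans (≤-reflexive (+-comm (suc c * q) q))
               (≤-trans (m≤m+n _ r) (≤-trans (m≤m+n _ q) (γ-room (s≤s⁻¹ c<k))))
      eq : ∀ c q r → q + r + suc c * q ≡ suc (suc c) * q + r
      eq = solve-∀

  far-γ-q : ∀ c → suc (suc c) < 4 + k' → Far (suc (suc c) * q + r) q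
  far-γ-q c c<k = far (suc c * q + r) (≤-trans (m≤m+n q (c * q)) (m≤m+n _ r)) room (≡⇒≋ (sym (+-assoc q (suc c * q) r)))
    where
      room : suc c * q + r + q ≤ p
      room = ≤-trans (≤-reflexive (trans (+-comm _ q) (sym (+-assoc q (suc c * q) r))))
               (≤-trans (m≤m+n _ q) (γ-room (s≤s⁻¹ c<k)))

  [p-q-1]+[q+1]≋0 : p-q-1 + (q + 1) ≋ 0
  [p-q-1]+[q+1]≋0 = ≡+p⇒≋ (eq q-1 r k')
    where eq : ∀ q-1 r k' → q-1 + ((2 + k') * suc q-1 + r) + (suc q-1 + 1) ≡ (4 + k') * suc q-1 + r
          eq = solve-∀

  [p-q-1]+[2q+1]≋q : p-q-1 + (q + q + 1) ≋ q
  [p-q-1]+[2q+1]≋q = ≡+p⇒≋ (eq q-1 r k')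
    where eq : ∀ q-1 r k' → q-1 + ((2 + k') * suc q-1 + r) + (suc q-1 + suc q-1 + 1) ≡ suc q-1 + ((4 + k') * suc q-1 + r)
          eq = solve-∀

  [p-q-1]+3q≋[2q-1] : p-q-1 + (q + q + q) ≋ q + q-1
  [p-q-1]+3q≋[2q-1] = ≡+p⇒≋ (eq q-1 r k')
    where eq : ∀ q-1 r k' → q-1 + ((2 + k') * suc q-1 + r) + (suc q-1 + suc q-1 + suc q-1) ≡ suc q-1 + q-1 + ((4 + k') * suc q-1 + r)
          eq = solve-∀

  [p-q-1]+q≡[p-1] : p-q-1 + q ≡ p-1
  [p-q-1]+q≡[p-1] = eq q-1 r k'
    where eq : ∀ q-1 r k' → q-1 + ((2 + k') * suc q-1 + r) + suc q-1 ≡ q-1 + ((3 + k') * suc q-1 + r)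
          eq = solve-∀

  far-0-[p-q-1] : Far 0 p-q-1
  far-0-[p-q-1] = far-gap (q + 1) (m≤m+n q 1) (≤-trans q+1≤2q 2q≤3q) [p-q-1]+[q+1]≋0

  far-q-[p-q-1] : Far q p-q-1
  far-q-[p-q-1] = far-gap (q + q + 1) (≤-trans q≤2q (m≤m+n _ 1)) (+-monoʳ-≤ (q + q) (s≤s z≤n)) [p-q-1]+[2q+1]≋q

  far-[2q-1]-[p-q-1] : Far (q + q-1) p-q-1
  far-[2q-1]-[p-q-1] = far-gap (q + q + q) q≤3q ≤-refl [p-q-1]+3q≋[2q-1]

  far-[p-1]-[p-q-1] : Far p-1 p-q-1
  far-[p-1]-[p-q-1] = far-gap≡ q ≤-refl q≤3q [p-q-1]+q≡[p-1]

  far-q-[p-1] : Far (1 * q) p-1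
  far-q-[p-1] = far-gap≡+p (q + 1) (m≤m+n q 1) (≤-trans q+1≤2q 2q≤3q) (eq q-1 r k')
    where eq : ∀ q-1 r k' → q-1 + ((3 + k') * suc q-1 + r) + (suc q-1 + 1) ≡ 1 * suc q-1 + ((4 + k') * suc q-1 + r)
          eq = solve-∀

  far-[3q-1]-[p-1] : Far (mid 1) p-1
  far-[3q-1]-[p-1] = far-gap≡+p (q + q + q) q≤3q ≤-refl (eq q-1 r k')
    where eq : ∀ q-1 r k' → q-1 + ((3 + k') * suc q-1 + r) + (suc q-1 + suc q-1 + suc q-1) ≡ 2 * suc q-1 + q-1 + ((4 + k') * suc q-1 + r)
          eq = solve-∀

  p∸q∸1≡p-q-1 : p ∸ q ∸ 1 ≡ p-q-1
  p∸q∸1≡p-q-1 = begin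
    p ∸ q ∸ 1            ≡⟨ ∸-+-assoc p q 1 ⟩
    p ∸ (q + 1)          ≡⟨ cong (_∸ (q + 1)) (eq q-1 r k') ⟨
    p-q-1 + (q + 1) ∸ (q + 1)  ≡⟨ m+n∸n≡m p-q-1 (q + 1) ⟩
    p-q-1                ∎
    where
      open ≡-Reasoning
      eq : ∀ q-1 r k' → q-1 + ((2 + k') * suc q-1 + r) + (suc q-1 + 1) ≡ (4 + k') * suc q-1 + r
      eq = solve-∀

  far-ends : ∀ x e → q ≤ e → e ≤ q + q + q → p-q-1 + e ≋ x → ∀ j → JoinedToEnds j → Far x j
  far-ends x e q≤e e≤3q ≋x j j∈ =
    far-from-interval {3 * q ∸ 1} {p ∸ q ∸ 1} j∈ (k' * q + r) e x
      (≡⇒≋ (trans (eq₁ q-1 r k') (sym p∸q∸1≡p-q-1)))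
      (subst (suc (k' * q + r) ≤_) (eq₂ q-1 r k') (m≤m+n _ (q-1 + q + q + q)))
      (≋-trans (≡⇒≋ (cong (_+ e) p∸q∸1≡p-q-1)) ≋x) q≤e
      (≤-trans (+-monoˡ-≤ q (+-monoʳ-≤ (k' * q + r) e≤3q)) (≤-reflexive (eq₃ q r k')))
    where
      eq₁ : ∀ q-1 r k' → q-1 + (suc q-1 + (suc q-1 + 0)) + (k' * suc q-1 + r) ≡ q-1 + ((2 + k') * suc q-1 + r)
      eq₁ = solve-∀
      eq₂ : ∀ q-1 r k' → suc (k' * suc q-1 + r) + (q-1 + suc q-1 + suc q-1 + suc q-1) ≡ (4 + k') * suc q-1 + r
      eq₂ = solve-∀
      eq₃ : ∀ q r k' → k' * q + r + (q + q + q) + q ≡ (4 + k') * q + r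
      eq₃ = solve-∀

  far-inner : ∀ i x e → q ≤ e → e ≤ q + q + q-1 → i * q + e ≋ x → ∀ j → JoinedToInner (suc i) j → Far x j
  far-inner i x e q≤e e≤ ≋x j j∈ =
    far-from-interval {(suc i + 3) * q ∸ 1} {i * q} j∈ (k' * q + r + 1) e x
      (≡+p⇒≋ (eq₁ q-1 r k' i))
      (subst (suc (k' * q + r + 1) ≤_) (eq₂ q-1 r k') (m≤m+n _ (q-1 + q-1 + q + q)))
      ≋x q≤e
      (≤-trans (+-monoˡ-≤ q (+-monoʳ-≤ (k' * q + r + 1) e≤)) (≤-reflexive (eq₃ q-1 r k')))
    where
      eq₁ : ∀ q-1 r k' i → q-1 + (i + 3) * suc q-1 + (k' * suc q-1 + r + 1) ≡ i * suc q-1 + ((4 + k') * suc q-1 + r)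
      eq₁ = solve-∀
      eq₂ : ∀ q-1 r k' → suc (k' * suc q-1 + r + 1) + (q-1 + q-1 + suc q-1 + suc q-1) ≡ (4 + k') * suc q-1 + r
      eq₂ = solve-∀
      eq₃ : ∀ q-1 r k' → k' * suc q-1 + r + 1 + (suc q-1 + suc q-1 + q-1) + suc q-1 ≡ (4 + k') * suc q-1 + r
      eq₃ = solve-∀

  q+q≤2q+q-1 : q + q ≤ q + q + q-1
  q+q≤2q+q-1 = m≤m+n (q + q) q-1

  far-0-ends : ∀ j → JoinedToEnds j → Far 0 j
  far-0-ends = far-ends 0 (q + 1) (m≤m+n q 1) (≤-trans q+1≤2q 2q≤3q) [p-q-1]+[q+1]≋0

  far-q-ends : ∀ j → JoinedToEnds j → Far q j
  far-q-ends = far-ends q (q + q + 1) (≤-trans q≤2q (m≤m+n _ 1)) (+-monoʳ-≤ (q + q) (s≤s z≤n)) [p-q-1]+[2q+1]≋q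

  far-[2q-1]-ends : ∀ j → JoinedToEnds j → Far (q + q-1) j
  far-[2q-1]-ends = far-ends (q + q-1) (q + q + q) q≤3q ≤-refl [p-q-1]+3q≋[2q-1]

  far-[p-1]-ends : ∀ j → JoinedToEnds j → Far p-1 j
  far-[p-1]-ends = far-ends p-1 q ≤-refl q≤3q (≡⇒≋ [p-q-1]+q≡[p-1])

  far-lo-inner : ∀ i j → JoinedToInner (suc i) j → Far (suc i * q) j
  far-lo-inner i = far-inner i _ q ≤-refl (≤-trans q≤2q q+q≤2q+q-1) (≡⇒≋ (+-comm (i * q) q))

  far-hi-inner : ∀ i j → JoinedToInner (suc i) j → Far (suc (suc i) * q) j
  far-hi-inner i = far-inner i _ (q + q) q≤2q q+q≤2q+q-1 (≡⇒≋ (eq i q))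
    where eq : ∀ i q → i * q + (q + q) ≡ suc (suc i) * q
          eq = solve-∀

  far-mid-inner : ∀ i j → JoinedToInner (suc i) j → Far (mid (suc i)) j
  far-mid-inner i = far-inner i _ (q + q + q-1) (≤-trans q≤2q q+q≤2q+q-1) ≤-refl (≡⇒≋ (eq i q q-1))
    where eq : ∀ i q q-1 → i * q + (q + q + q-1) ≡ suc (suc i) * q + q-1
          eq = solve-∀

  module Main (wrap : suc t * q ≋ r) where

    far-0-[t-1]q : Far 0 (suc t0 * q)
    far-0-[t-1]q = far-gap (q + suc s0) (m≤m+n q _) (≤-trans (+-monoʳ-≤ q 1+s0≤q) 2q≤3q)
      (≋-cancelʳ r (≋-trans (≡⇒≋ (eq r0 s0 t0)) wrap))
      where eq : ∀ r0 s0 t0 → suc t0 * suc (suc r0 + s0) + (suc (suc r0 + s0) + suc s0) + suc r0 ≡ suc (suc (suc t0)) * suc (suc r0 + s0)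
            eq = solve-∀

    far-q-[t-1]q : Far q (suc t0 * q)
    far-q-[t-1]q = far-gap (q + q + suc s0) (≤-trans q≤2q (m≤m+n _ _)) (+-monoʳ-≤ (q + q) 1+s0≤q)
      (≋-cancelʳ r (≋-trans (≡⇒≋ (eq r0 s0 t0)) (≋-trans (≋-+ʳ q wrap) (≡⇒≋ (+-comm r q)))))
      where eq : ∀ r0 s0 t0 → suc t0 * suc (suc r0 + s0) + (suc (suc r0 + s0) + suc (suc r0 + s0) + suc s0) + suc r0 ≡ suc (suc (suc t0)) * suc (suc r0 + s0) + suc (suc r0 + s0)
            eq = solve-∀

    [p-q-1]+[q+1+r]≋[t+1]q : p-q-1 + (q + 1 + r) ≋ suc t * q
    [p-q-1]+[q+1+r]≋[t+1]q = ≋-trans (≡+p⇒≋ (eq q-1 r k')) (≋-sym wrap)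
      where eq : ∀ q-1 r k' → q-1 + ((2 + k') * suc q-1 + r) + (suc q-1 + 1 + r) ≡ r + ((4 + k') * suc q-1 + r)
            eq = solve-∀

    far-[p-q-1]-[t-2]q : Far p-q-1 (t0 * q)
    far-[p-q-1]-[t-2]q = far-gap (q + s0) (m≤m+n q s0) (≤-trans (+-monoʳ-≤ q (≤-trans (n≤1+n s0) 1+s0≤q)) 2q≤3q)
      (≋-cancelʳ (q + 1 + r) (≋-trans (≡⇒≋ (eq r0 s0 t0)) (≋-sym [p-q-1]+[q+1+r]≋[t+1]q)))
      where eq : ∀ r0 s0 t0 → t0 * suc (suc r0 + s0) + (suc (suc r0 + s0) + s0) + (suc (suc r0 + s0) + 1 + suc r0) ≡ suc (suc (suc t0)) * suc (suc r0 + s0)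
            eq = solve-∀

    far-γ-[t+1]q : ∀ c → suc c < 4 + k' → Far (suc c * q + r) (suc t * q)
    far-γ-[t+1]q c c<k = far (suc c * q) (m≤m+n q (c * q))
      (≤-trans (+-monoˡ-≤ q (m≤m+n (suc c * q) r)) (γ-room (s≤s⁻¹ c<k)))
      (≋-trans (≋-+ʳ (suc c * q) wrap) (≡⇒≋ (+-comm r _)))

    far-γ-mid : ∀ c → suc (suc c) < 4 + k' → Far (suc (suc c) * q + r) (mid t)
    far-γ-mid c c<k = far (suc c * q + 1) (≤-trans (m≤m+n q (c * q)) (m≤m+n _ 1)) room
      (≋-trans (≡⇒≋ (eq₁ (suc t * q) q-1 (suc c * q))) (≋-trans (≋-+ʳ (q + suc c * q) wrap) (≡⇒≋ (+-comm r _))))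
      where
        eq₁ : ∀ X q-1 y → X + q-1 + (y + 1) ≡ X + (suc q-1 + y)
        eq₁ = solve-∀
        eq₂ : ∀ c q → suc c * q + 1 + q ≡ suc (suc c) * q + 1
        eq₂ = solve-∀
        room : suc c * q + 1 + q ≤ p
        room = ≤-trans (≤-reflexive (eq₂ c q))
                 (≤-trans (+-monoʳ-≤ (suc (suc c) * q) (s≤s z≤n)) (≤-trans (m≤m+n _ q) (γ-room (s≤s⁻¹ c<k))))

    far-[t+1]q-ends : ∀ j → JoinedToEnds j → Far (suc t * q) j
    far-[t+1]q-ends = far-ends _ (q + 1 + r) (≤-trans (m≤m+n q 1) (m≤m+n (q + 1) r))
      (+-mono-≤ q+1≤2q (<⇒≤ r<q)) [p-q-1]+[q+1+r]≋[t+1]q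

    far-mid-ends : ∀ j → JoinedToEnds j → Far (mid t) j
    far-mid-ends = far-ends _ (q + 1 + r + q-1) (≤-trans (m≤m+n q 1) (≤-trans (m≤m+n (q + 1) r) (m≤m+n _ q-1)))
      (+-mono-≤ (≤-trans (≤-reflexive (+-assoc q 1 r)) (+-monoʳ-≤ q r<q)) q-1≤q)
      (≋-trans (≡⇒≋ (sym (+-assoc p-q-1 (q + 1 + r) q-1))) (≋-+ʳ q-1 [p-q-1]+[q+1+r]≋[t+1]q))

    far-[p-q-1]-inner : ∀ j → JoinedToInner (suc t0) j → Far p-q-1 j
    far-[p-q-1]-inner = far-inner t0 _ (q + s0) (m≤m+n q s0)
      (≤-trans (+-monoʳ-≤ q (≤-trans (n≤1+n s0) 1+s0≤q)) q+q≤2q+q-1) (Far.y+gap≋x far-[p-q-1]-[t-2]q)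

    out-lowering : ℕ → ℕ → ℕ
    out-lowering m i = if i <ᵇ m then i * q else suc i * q

    out-raising : ℕ → ℕ → ℕ
    out-raising m i = if i <ᵇ m then suc i * q else mid i

    out-from-mid : ℕ → ℕ → ℕ
    out-from-mid m zero = p-1
    out-from-mid m (suc i) = if suc i <ᵇ m then suc i * q else mid (suc i)

    out-final : ℕ → ℕ
    out-final i = if i <ᵇ t then i * q else 0

    out-final′ : ℕ → ℕ
    out-final′ zero = p-1
    out-final′ (suc i) = if suc i <ᵇ t then suc i * q else 0

    in-ending : ℕ → ℕ → ℕ → ℕ
    in-ending w₁ w₂ i = if i ≡ᵇ t then w₂ else (if i ≡ᵇ suc t0 then w₁ else i * q)

    1*q≡q : 1 * q ≡ q
    1*q≡q = *-identityˡ q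

    out-lowering-ok : ∀ m → m ≤ t → ∀ c → suc c < 4 + k' → OutPathOK (out-lowering m) (suc c * q + r)
    out-lowering-ok m m≤t c c<k = record
      { out-end = far-subst (if-≮ (≤⇒≯ m≤t)) refl (far-sym (far-γ-[t+1]q c c<k))
      ; out-steps = steps
      ; out-first-y = first-y
      ; out-last-y = λ j y → far-subst (if-≮ (≤⇒≯ m≤t)) refl (far-[t+1]q-ends j y)
      ; out-inner-y = inner-y }
      where
        steps : ∀ i → i < t → Far (out-lowering m i) (out-lowering m (suc i))
        steps i _ with suc i <? m | i <? m
        ... | yes i+1<m | _ = far-subst (if-< (<-trans (n<1+n i) i+1<m)) (if-< i+1<m) (far-sym (far-step i))
        ... | no i+1≮m | yes i<m = far-subst (if-< i<m) (if-≮ i+1≮m) (far-sym (far-step₂ i))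
        ... | no i+1≮m | no i≮m = far-subst (if-≮ i≮m) (if-≮ i+1≮m) (far-sym (far-step (suc i)))
        first-y : ∀ j → JoinedToEnds j → Far (out-lowering m 0) j
        first-y j y with 0 <? m
        ... | yes 0<m = far-subst (if-< 0<m) refl (far-0-ends j y)
        ... | no 0≮m = far-subst (trans (if-≮ 0≮m) 1*q≡q) refl (far-q-ends j y)
        inner-y : ∀ i j → 1 ≤ i → i ≤ t ∸ 1 → JoinedToInner i j → Far (out-lowering m i) j
        inner-y (suc i) j _ _ y with suc i <? m
        ... | yes i+1<m = far-subst (if-< i+1<m) refl (far-lo-inner i j y)
        ... | no i+1≮m = far-subst (if-≮ i+1≮m) refl (far-hi-inner i j y)

    out-final-ok : ∀ c → suc c < 4 + k' → OutPathOK out-final (suc c * q + r)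
    out-final-ok c c<k = record
      { out-end = far-subst (if-≮ (n≮n t)) refl (far-sym (far-γ-0 c c<k))
      ; out-steps = steps
      ; out-first-y = far-0-ends
      ; out-last-y = λ j y → far-subst (if-≮ (n≮n t)) refl (far-0-ends j y)
      ; out-inner-y = λ { (suc i) j _ i≤ y → far-subst (if-< (s≤s i≤)) refl (far-lo-inner i j y) } }
      where
        steps : ∀ i → i < t → Far (out-final i) (out-final (suc i))
        steps i i<t with suc i <? t
        ... | yes i+1<t = far-subst (if-< i<t) (if-< i+1<t) (far-sym (far-step i))
        ... | no i+1≮t = far-subst (if-< i<t) (if-≮ i+1≮t)
                           (subst (λ z → Far (z * q) 0) (sym i≡t-1) (far-sym far-0-[t-1]q))
          where i≡t-1 : i ≡ suc t0
                i≡t-1 = suc-injective (≤-antisym i<t (≮⇒≥ i+1≮t))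

    out-raising-ok : ∀ m → m ≤ suc t → ∀ c → suc (suc c) < 4 + k' →
                     OutPathOK (out-raising m) (suc (suc c) * q + r)
    out-raising-ok m m≤ c c<k = record
      { out-end = end ; out-steps = steps ; out-first-y = first-y ; out-last-y = last-y ; out-inner-y = inner-y }
      where
        end : Far (out-raising m t) (suc (suc c) * q + r)
        end with t <? m
        ... | yes t<m = far-subst (if-< t<m) refl (far-sym (far-γ-[t+1]q (suc c) c<k))
        ... | no t≮m = far-subst (if-≮ t≮m) refl (far-sym (far-γ-mid c c<k))
        steps : ∀ i → i < t → Far (out-raising m i) (out-raising m (suc i))
        steps i _ with suc i <? m | i <? m
        ... | yes i+1<m | _ = far-subst (if-< (<-trans (n<1+n i) i+1<m)) (if-< i+1<m) (far-sym (far-step (suc i)))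
        ... | no i+1≮m | yes i<m = far-subst (if-< i<m) (if-≮ i+1≮m) (far-sym (far-mid-hi i))
        ... | no i+1≮m | no i≮m = far-subst (if-≮ i≮m) (if-≮ i+1≮m) (far-sym (far-mid-step i))
        first-y : ∀ j → JoinedToEnds j → Far (out-raising m 0) j
        first-y j y with 0 <? m
        ... | yes 0<m = far-subst (trans (if-< 0<m) 1*q≡q) refl (far-q-ends j y)
        ... | no 0≮m = far-subst (trans (if-≮ 0≮m) (cong (_+ q-1) 1*q≡q)) refl (far-[2q-1]-ends j y)
        last-y : ∀ j → JoinedToEnds j → Far (out-raising m t) j
        last-y j y with t <? m
        ... | yes t<m = far-subst (if-< t<m) refl (far-[t+1]q-ends j y)
        ... | no t≮m = far-subst (if-≮ t≮m) refl (far-mid-ends j y)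
        inner-y : ∀ i j → 1 ≤ i → i ≤ t ∸ 1 → JoinedToInner i j → Far (out-raising m i) j
        inner-y (suc i) j _ _ y with suc i <? m
        ... | yes i+1<m = far-subst (if-< i+1<m) refl (far-hi-inner i j y)
        ... | no i+1≮m = far-subst (if-≮ i+1≮m) refl (far-mid-inner i j y)

    out-from-mid-ok : ∀ m → m ≤ t → ∀ c → suc (suc c) < 4 + k' →
                      OutPathOK (out-from-mid m) (suc (suc c) * q + r)
    out-from-mid-ok m m≤t c c<k = record
      { out-end = far-subst (if-≮ (≤⇒≯ m≤t)) refl (far-sym (far-γ-mid c c<k))
      ; out-steps = steps
      ; out-first-y = far-[p-1]-ends
      ; out-last-y = λ j y → far-subst (if-≮ (≤⇒≯ m≤t)) refl (far-mid-ends j y)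
      ; out-inner-y = inner-y }
      where
        steps : ∀ i → i < t → Far (out-from-mid m i) (out-from-mid m (suc i))
        steps zero _ with 1 <? m
        ... | yes 1<m = far-subst refl (if-< 1<m) (far-sym far-q-[p-1])
        ... | no 1≮m = far-subst refl (if-≮ 1≮m) (far-sym far-[3q-1]-[p-1])
        steps (suc i) _ with suc (suc i) <? m | suc i <? m
        ... | yes i+2<m | _ = far-subst (if-< (<-trans (n<1+n (suc i)) i+2<m)) (if-< i+2<m) (far-sym (far-step (suc i)))
        ... | no i+2≮m | yes i+1<m = far-subst (if-< i+1<m) (if-≮ i+2≮m) (far-sym (far-mid-lo (suc i)))
        ... | no i+2≮m | no i+1≮m = far-subst (if-≮ i+1≮m) (if-≮ i+2≮m) (far-sym (far-mid-step (suc i)))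
        inner-y : ∀ i j → 1 ≤ i → i ≤ t ∸ 1 → JoinedToInner i j → Far (out-from-mid m i) j
        inner-y (suc i) j _ _ y with suc i <? m
        ... | yes i+1<m = far-subst (if-< i+1<m) refl (far-lo-inner i j y)
        ... | no i+1≮m = far-subst (if-≮ i+1≮m) refl (far-mid-inner i j y)

    out-final′-ok : ∀ c → suc c < 4 + k' → OutPathOK out-final′ (suc c * q + r)
    out-final′-ok c c<k = record
      { out-end = far-subst (if-≮ (n≮n t)) refl (far-sym (far-γ-0 c c<k))
      ; out-steps = steps
      ; out-first-y = far-[p-1]-ends
      ; out-last-y = λ j y → far-subst (if-≮ (n≮n t)) refl (far-0-ends j y)
      ; out-inner-y = λ { (suc i) j _ i≤ y → far-subst (if-< (s≤s i≤)) refl (far-lo-inner i j y) } }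
      where
        steps : ∀ i → i < t → Far (out-final′ i) (out-final′ (suc i))
        steps zero _ = far-sym far-q-[p-1]
        steps (suc i) i<t with suc (suc i) <? t
        ... | yes i+2<t = far-subst (if-< i<t) (if-< i+2<t) (far-sym (far-step (suc i)))
        ... | no i+2≮t = far-subst (if-< i<t) (if-≮ i+2≮t)
                           (subst (λ z → Far (z * q) 0) (sym i+1≡t-1) (far-sym far-0-[t-1]q))
          where i+1≡t-1 : suc i ≡ suc t0
                i+1≡t-1 = suc-injective (≤-antisym i<t (≮⇒≥ i+2≮t))

    in-ending-t : ∀ {w₁ w₂} → in-ending w₁ w₂ t ≡ w₂
    in-ending-t = if-≡ {m = t} refl

    in-ending-t-1 : ∀ {w₁ w₂} → in-ending w₁ w₂ (suc t0) ≡ w₁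
    in-ending-t-1 = trans (if-≢ {m = suc t0} {n = t} (λ ())) (if-≡ {m = suc t0} refl)

    in-ending-< : ∀ {w₁ w₂} i → ¬ i ≡ t → ¬ i ≡ suc t0 → in-ending w₁ w₂ i ≡ i * q
    in-ending-< i i≢t i≢t-1 = trans (if-≢ i≢t) (if-≢ i≢t-1)

    in-ending-ok : ∀ w₁ w₂ → Far (t0 * q) w₁ → Far w₁ w₂ → (∀ j → JoinedToEnds j → Far w₂ j) →
                   (∀ j → JoinedToInner (suc t0) j → Far w₁ j) →
                   ∀ c → suc c < 4 + k' → InPathOK (in-ending w₁ w₂) (suc c * q + r)
    in-ending-ok w₁ w₂ far-w₁ far-w₂ w₂-y w₁-y c c<k = record
      { in-end = far-γ-0 c c<k
      ; in-steps = steps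
      ; in-first-y = far-0-ends
      ; in-last-y = λ j y → far-subst in-ending-t refl (w₂-y j y)
      ; in-inner-y = inner-y }
      where
        steps : ∀ i → i < t → Far (in-ending w₁ w₂ i) (in-ending w₁ w₂ (suc i))
        steps i i<t with i ≟ suc t0 | i ≟ t0
        ... | yes refl | _ = far-subst in-ending-t-1 in-ending-t far-w₂
        ... | no _ | yes refl = far-subst (in-ending-< t0 (λ ()) (λ ())) in-ending-t-1 far-w₁
        ... | no i≢t-1 | no i≢t-2 =
              far-subst (in-ending-< i (λ i≡t → <-irrefl i≡t i<t) i≢t-1)
                        (in-ending-< (suc i) (λ e → i≢t-1 (suc-injective e)) (λ e → i≢t-2 (suc-injective e)))
                        (far-sym (far-step i))
        inner-y : ∀ i j → 1 ≤ i → i ≤ t ∸ 1 → JoinedToInner i j → Far (in-ending w₁ w₂ i) j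
        inner-y (suc i) j _ i≤ y with i ≟ t0
        ... | yes refl = far-subst in-ending-t-1 refl (w₁-y j y)
        ... | no i≢t-2 = far-subst (in-ending-< (suc i) (λ i≡t → <-irrefl i≡t (s≤s i≤)) (λ e → i≢t-2 (suc-injective e)))
                           refl (far-lo-inner i j y)

    in-init in-final : ℕ → ℕ
    in-init = in-ending (suc t0 * q) q
    in-final = in-ending (suc t0 * q) 0

    in-ending-lo : ∀ {w₂} i → i < t → in-ending (suc t0 * q) w₂ i ≡ i * q
    in-ending-lo i i<t with i ≟ suc t0
    ... | yes refl = in-ending-t-1
    ... | no i≢t-1 = in-ending-< i (λ i≡t → <-irrefl i≡t i<t) i≢t-1

    in-init-ok : ∀ c → suc c < 4 + k' → InPathOK in-init (suc c * q + r)
    in-init-ok = in-ending-ok _ _ (far-sym (far-step t0)) (far-sym far-q-[t-1]q) far-q-ends (far-lo-inner t0)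

    in-final-ok : ∀ c → suc c < 4 + k' → InPathOK in-final (suc c * q + r)
    in-final-ok = in-ending-ok _ _ (far-sym (far-step t0)) (far-sym far-0-[t-1]q) far-0-ends (far-lo-inner t0)

    in-detour-ok : ∀ w → Far w p-q-1 → (∀ j → JoinedToEnds j → Far w j) →
                   ∀ c → suc c < 4 + k' → InPathOK (in-ending p-q-1 w) (suc c * q + r)
    in-detour-ok w far-w w-y = in-ending-ok _ _ (far-sym far-[p-q-1]-[t-2]q) (far-sym far-w) w-y far-[p-q-1]-inner

    module Schedules (G : Graph) (u : Fin (n G)) (η : V' G p t → Fin p)
                     (η-valid : IsPQColouring G p q t η) (η-y : ∀ i → η (yv i) ≡ i) where
      open Reconfiguration G p q t
      open Repaint G p q t u η η-valid η-y
      open EdgeFacts G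

      NeighboursAvoid : ℕ → Set
      NeighboursAvoid b = ∀ w → Edge G u w →
        Σ ℕ λ c → suc c < 4 + k' × ¬ suc c ≡ b × toℕ (η (old w)) ≡ (suc c * q + r) % p

      CompatibleWith : ℕ → ℕ → PathState → Set
      CompatibleWith b U P = ∀ c → suc c < 4 + k' → ¬ suc c ≡ b → Compatible U P (suc c * q + r)

      around : ∀ {b U P} → NeighboursAvoid b → CompatibleWith b U P → CompatibleAround U (λ _ → P)
      around avoid ok w e = let (c , c<k , c≢b , ηw≡) = avoid w e in _ , ηw≡ , ok c c<k c≢b

      around₂ : ∀ {b U P P'} → NeighboursAvoid b → CompatibleWith b U P → CompatibleWith b U P' →
                CompatibleAround₂ U P P'
      around₂ avoid ok ok' w e = let (c , c<k , c≢b , ηw≡) = avoid w e in _ , ηw≡ , ok c c<k c≢b , ok' c c<k c≢b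

      off-out : ∀ {A A' W} m → (∀ i → i ≤ t → ¬ i ≡ m → A i ≡ A' i) → AgreeOff (out-slot m) (paths A W) (paths A' W)
      off-out m agree = agree , λ _ _ → refl

      off-in-t : ∀ {A w₁ w₂ w₂'} → AgreeOff (in-slot t) (paths A (in-ending w₁ w₂)) (paths A (in-ending w₁ w₂'))
      off-in-t = (λ _ _ → refl) , λ i _ i≢t → trans (if-≢ i≢t) (sym (if-≢ i≢t))

      off-in-t-1 : ∀ {A w₁ w₁' w₂} → AgreeOff (in-slot (suc t0)) (paths A (in-ending w₁ w₂)) (paths A (in-ending w₁' w₂))
      off-in-t-1 = (λ _ _ → refl) , agree
        where
          agree : ∀ {w₁ w₁' w₂} i → i ≤ t → ¬ i ≡ suc t0 → in-ending w₁ w₂ i ≡ in-ending w₁' w₂ i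
          agree i _ i≢t-1 with i ≟ t
          ... | yes i≡t = trans (if-≡ i≡t) (sym (if-≡ i≡t))
          ... | no i≢t = trans (in-ending-< i i≢t i≢t-1) (sym (in-ending-< i i≢t i≢t-1))

      final : PathState
      final = paths out-final in-final

      -- u moves straight to γ b; then the incoming paths end in 0 and the
      -- outgoing ones are lowered from x_i = (i + 1)q to iq one vertex at a time.
      module ToLarge (b : ℕ) (b<k : suc (suc b) < 4 + k') (avoid : NeighboursAvoid (suc (suc b))) where
        γb = suc (suc b) * q + r

        lowering-start : PathState
        lowering-start = paths (out-lowering 0) in-init

        far-γb-first : ∀ m → Far γb (out-lowering m 0)
        far-γb-first m with 0 <? m
        ... | yes 0<m = far-subst refl (if-< 0<m) (far-γ-0 (suc b) b<k)
        ... | no 0≮m = far-subst refl (trans (if-≮ 0≮m) 1*q≡q) (far-γ-q b b<k)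

        far-γb-nbr : ∀ c → suc c < 4 + k' → ¬ suc c ≡ suc (suc b) → Far γb (suc c * q + r)
        far-γb-nbr c c<k c≢b = far-γ-γ (suc b) c b<k c<k (λ c≡b → c≢b (cong suc c≡b))

        ok-start : CompatibleWith (suc (suc b)) 0 lowering-start
        ok-start c c<k _ = compatible (far-sym (far-γ-0 c c<k)) (far-subst refl 1*q≡q far-0-q)
          (far-subst refl in-ending-t far-0-q) (out-lowering-ok 0 z≤n c c<k) (in-init-ok c c<k)

        ok-recoloured : CompatibleWith (suc (suc b)) γb lowering-start
        ok-recoloured c c<k c≢b = compatible (far-γb-nbr c c<k c≢b) (far-γb-first 0)
          (far-subst refl in-ending-t (far-γ-q b b<k)) (out-lowering-ok 0 z≤n c c<k) (in-init-ok c c<k)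

        ok-lowering : ∀ m → m ≤ t → CompatibleWith (suc (suc b)) γb (paths (out-lowering m) in-final)
        ok-lowering m m≤t c c<k c≢b = compatible (far-γb-nbr c c<k c≢b) (far-γb-first m)
          (far-subst refl in-ending-t (far-γ-0 (suc b) b<k)) (out-lowering-ok m m≤t c c<k) (in-final-ok c c<k)

        ok-final : CompatibleWith (suc (suc b)) γb final
        ok-final c c<k c≢b = compatible (far-γb-nbr c c<k c≢b) (far-γ-0 (suc b) b<k)
          (far-subst refl in-ending-t (far-γ-0 (suc b) b<k)) (out-final-ok c c<k) (in-final-ok c c<k)

        lowered-final : ∀ i → i ≤ t → ¬ i ≡ t → out-lowering t i ≡ out-final i
        lowered-final i i≤t i≢t = trans (if-< (≤∧≢⇒< i≤t i≢t)) (sym (if-< (≤∧≢⇒< i≤t i≢t)))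

        start-valid : IsPQColouring G p q t (repaint 0 (λ _ → lowering-start))
        start-valid = repaint-valid (around avoid ok-start)

        final-valid : IsPQColouring G p q t (repaint γb (λ _ → final))
        final-valid = repaint-valid (around avoid ok-final)

        run : Reconf G p q t (repaint 0 (λ _ → lowering-start)) (repaint γb (λ _ → final))
        run = recolour-centre 0 γb (λ _ → lowering-start) (around avoid ok-recoloured)
          ++ switch-paths γb _ _ (in-slot t) off-in-t (around₂ avoid ok-recoloured (ok-lowering 0 z≤n))
          ++ chain-up (λ m → repaint γb (λ _ → paths (out-lowering m) in-final)) t
               (λ m m<t → switch-paths γb _ _ (out-slot m) (off-out m λ i _ → if-<-suc)
                            (around₂ avoid (ok-lowering m (<⇒≤ m<t)) (ok-lowering (suc m) m<t)))
          ++ switch-paths γb _ _ (out-slot t) (off-out t lowered-final) (around₂ avoid (ok-lowering t ≤-refl) ok-final)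

      -- γ 1 = q + r is too close to 0 to be reached directly: u goes through
      -- q − 1, the outgoing paths pass through x_i = (i + 1)q + q − 1 and
      -- x_0 = p − 1, and the incoming ones through x_{t−1} = p − q − 1.
      module ToOne (avoid : NeighboursAvoid 1) where
        in-detour : ℕ → ℕ → ℕ
        in-detour = in-ending p-q-1

        raised-start : PathState
        raised-start = paths (out-raising (suc t)) in-init

        from-two : ∀ {U P} → (∀ c → suc (suc c) < 4 + k' → Compatible U P (suc (suc c) * q + r)) →
                   CompatibleWith 1 U P
        from-two ok zero _ c≢0 = ⊥-elim (c≢0 refl)
        from-two ok (suc c) c<k _ = ok c c<k

        far-0-first : ∀ m → Far 0 (out-raising m 0)
        far-0-first m with 0 <? m
        ... | yes 0<m = far-subst refl (trans (if-< 0<m) 1*q≡q) far-0-q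
        ... | no 0≮m = far-subst refl (trans (if-≮ 0≮m) (cong (_+ q-1) 1*q≡q)) far-0-[2q-1]

        far-[q-1]-first : Far q-1 (out-raising 0 0)
        far-[q-1]-first = far-subst refl (cong (_+ q-1) 1*q≡q) (far-sym far-[2q-1]-[q-1])

        ok-start : CompatibleWith 1 0 raised-start
        ok-start = from-two λ c c<k → compatible (far-sym (far-γ-0 (suc c) c<k)) (far-0-first (suc t))
          (far-subst refl in-ending-t far-0-q) (out-raising-ok (suc t) ≤-refl c c<k) (in-init-ok (suc c) c<k)

        ok-raising : ∀ m → m ≤ suc t → CompatibleWith 1 0 (paths (out-raising m) (in-detour q))
        ok-raising m m≤ = from-two λ c c<k → compatible (far-sym (far-γ-0 (suc c) c<k)) (far-0-first m)
          (far-subst refl in-ending-t far-0-q) (out-raising-ok m m≤ c c<k)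
          (in-detour-ok q far-q-[p-q-1] far-q-ends (suc c) c<k)

        ok-raised : CompatibleWith 1 0 (paths (out-raising 0) (in-detour (q + q-1)))
        ok-raised = from-two λ c c<k → compatible (far-sym (far-γ-0 (suc c) c<k)) (far-0-first 0)
          (far-subst refl in-ending-t far-0-[2q-1]) (out-raising-ok 0 z≤n c c<k)
          (in-detour-ok (q + q-1) far-[2q-1]-[p-q-1] far-[2q-1]-ends (suc c) c<k)

        ok-raised′ : CompatibleWith 1 q-1 (paths (out-raising 0) (in-detour (q + q-1)))
        ok-raised′ = from-two λ c c<k → compatible (far-sym (far-γ-[q-1] c c<k)) far-[q-1]-first
          (far-subst refl in-ending-t (far-sym far-[2q-1]-[q-1])) (out-raising-ok 0 z≤n c c<k)
          (in-detour-ok (q + q-1) far-[2q-1]-[p-q-1] far-[2q-1]-ends (suc c) c<k)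

        ok-from-mid : ∀ m → m ≤ t → CompatibleWith 1 q-1 (paths (out-from-mid m) (in-detour (q + q-1)))
        ok-from-mid m m≤t = from-two λ c c<k → compatible (far-sym (far-γ-[q-1] c c<k)) (far-sym far-[p-1]-[q-1])
          (far-subst refl in-ending-t (far-sym far-[2q-1]-[q-1])) (out-from-mid-ok m m≤t c c<k)
          (in-detour-ok (q + q-1) far-[2q-1]-[p-q-1] far-[2q-1]-ends (suc c) c<k)

        ok-tail : CompatibleWith 1 q-1 (paths out-final′ (in-detour (q + q-1)))
        ok-tail = from-two λ c c<k → compatible (far-sym (far-γ-[q-1] c c<k)) (far-sym far-[p-1]-[q-1])
          (far-subst refl in-ending-t (far-sym far-[2q-1]-[q-1])) (out-final′-ok (suc c) c<k)
          (in-detour-ok (q + q-1) far-[2q-1]-[p-q-1] far-[2q-1]-ends (suc c) c<k)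

        ok-tail′ : CompatibleWith 1 q-1 (paths out-final′ (in-detour p-1))
        ok-tail′ = from-two λ c c<k → compatible (far-sym (far-γ-[q-1] c c<k)) (far-sym far-[p-1]-[q-1])
          (far-subst refl in-ending-t (far-sym far-[p-1]-[q-1])) (out-final′-ok (suc c) c<k)
          (in-detour-ok p-1 far-[p-1]-[p-q-1] far-[p-1]-ends (suc c) c<k)

        ok-recoloured : CompatibleWith 1 (q + r) (paths out-final′ (in-detour p-1))
        ok-recoloured = from-two λ c c<k → compatible (far-sym (far-γ-[q+r] c c<k)) far-[q+r]-[p-1]
          (far-subst refl in-ending-t far-[q+r]-[p-1]) (out-final′-ok (suc c) c<k)
          (in-detour-ok p-1 far-[p-1]-[p-q-1] far-[p-1]-ends (suc c) c<k)

        ok-lowered : CompatibleWith 1 (q + r) (paths out-final (in-detour p-1))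
        ok-lowered = from-two λ c c<k → compatible (far-sym (far-γ-[q+r] c c<k)) far-[q+r]-0
          (far-subst refl in-ending-t far-[q+r]-[p-1]) (out-final-ok (suc c) c<k)
          (in-detour-ok p-1 far-[p-1]-[p-q-1] far-[p-1]-ends (suc c) c<k)

        ok-lowered′ : CompatibleWith 1 (q + r) (paths out-final (in-detour 0))
        ok-lowered′ = from-two λ c c<k → compatible (far-sym (far-γ-[q+r] c c<k)) far-[q+r]-0
          (far-subst refl in-ending-t far-[q+r]-0) (out-final-ok (suc c) c<k)
          (in-detour-ok 0 far-0-[p-q-1] far-0-ends (suc c) c<k)

        ok-final : CompatibleWith 1 (q + r) final
        ok-final = from-two λ c c<k → compatible (far-sym (far-γ-[q+r] c c<k)) far-[q+r]-0
          (far-subst refl in-ending-t far-[q+r]-0) (out-final-ok (suc c) c<k) (in-final-ok (suc c) c<k)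

        from-mid-final′ : ∀ i → i ≤ t → ¬ i ≡ t → out-from-mid t i ≡ out-final′ i
        from-mid-final′ zero _ _ = refl
        from-mid-final′ (suc i) i≤t i≢t = trans (if-< (≤∧≢⇒< i≤t i≢t)) (sym (if-< (≤∧≢⇒< i≤t i≢t)))

        final′-final : ∀ i → i ≤ t → ¬ i ≡ 0 → out-final′ i ≡ out-final i
        final′-final zero _ i≢0 = ⊥-elim (i≢0 refl)
        final′-final (suc i) _ _ = refl

        raised-from-mid : ∀ i → i ≤ t → ¬ i ≡ 0 → out-raising 0 i ≡ out-from-mid 1 i
        raised-from-mid zero _ i≢0 = ⊥-elim (i≢0 refl)
        raised-from-mid (suc i) _ _ = refl

        from-mid-suc : ∀ m i → i ≤ t → ¬ i ≡ m → out-from-mid m i ≡ out-from-mid (suc m) i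
        from-mid-suc m zero _ _ = refl
        from-mid-suc m (suc i) _ i≢m = if-<-suc i≢m

        start-valid : IsPQColouring G p q t (repaint 0 (λ _ → raised-start))
        start-valid = repaint-valid (around avoid ok-start)

        final-valid : IsPQColouring G p q t (repaint (q + r) (λ _ → final))
        final-valid = repaint-valid (around avoid ok-final)

        run : Reconf G p q t (repaint 0 (λ _ → raised-start)) (repaint (q + r) (λ _ → final))
        run = switch-paths 0 _ _ (in-slot (suc t0)) off-in-t-1 (around₂ avoid ok-start (ok-raising (suc t) ≤-refl))
          ++ chain-down (λ m → repaint 0 (λ _ → paths (out-raising m) (in-detour q))) (suc t)
               (λ m m<1+t → switch-paths 0 _ _ (out-slot m) (off-out m λ i _ i≢m → sym (if-<-suc i≢m))
                              (around₂ avoid (ok-raising (suc m) m<1+t) (ok-raising m (<⇒≤ m<1+t))))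
          ++ switch-paths 0 _ _ (in-slot t) off-in-t (around₂ avoid (ok-raising 0 z≤n) ok-raised)
          ++ recolour-centre 0 q-1 _ (around avoid ok-raised′)
          ++ switch-paths q-1 _ _ (out-slot 0) (off-out 0 raised-from-mid) (around₂ avoid ok-raised′ (ok-from-mid 1 (s≤s z≤n)))
          ++ chain-up (λ m → repaint q-1 (λ _ → paths (out-from-mid (suc m)) (in-detour (q + q-1)))) (suc t0)
               (λ m m<t-1 → switch-paths q-1 _ _ (out-slot (suc m)) (off-out (suc m) (from-mid-suc (suc m)))
                              (around₂ avoid (ok-from-mid (suc m) (m<n⇒m<1+n m<t-1)) (ok-from-mid (suc (suc m)) (s≤s m<t-1))))
          ++ switch-paths q-1 _ _ (out-slot t) (off-out t from-mid-final′) (around₂ avoid (ok-from-mid t ≤-refl) ok-tail)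
          ++ switch-paths q-1 _ _ (in-slot t) off-in-t (around₂ avoid ok-tail ok-tail′)
          ++ recolour-centre q-1 (q + r) _ (around avoid ok-recoloured)
          ++ switch-paths (q + r) _ _ (out-slot 0) (off-out 0 final′-final) (around₂ avoid ok-recoloured ok-lowered)
          ++ switch-paths (q + r) _ _ (in-slot t) off-in-t (around₂ avoid ok-lowered ok-lowered′)
          ++ switch-paths (q + r) _ _ (in-slot (suc t0)) off-in-t-1 (around₂ avoid ok-lowered′ ok-final)

      <t⊎≡fromℕ : ∀ (i : Fin (suc t)) → toℕ i < t ⊎ i ≡ fromℕ t
      <t⊎≡fromℕ i with toℕ i <? t
      ... | yes i<t = inj₁ i<t
      ... | no i≮t = inj₂ (toℕ-injective (trans (≤-antisym (s≤s⁻¹ (toℕ<n i)) (≮⇒≥ i≮t)) (sym (toℕ-fromℕ t))))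

      Recolouring : ℕ → Set
      Recolouring U = Σ (V' G p t → Fin p) λ η' → IsPQColouring G p q t η' × Standard G p q t η'
        × toℕ (η' (old u)) ≡ U × (∀ v → ¬ v ≡ u → η' (old v) ≡ η (old v)) × Reconf G p q t η η'

      module FromStandard (η-std : Standard G p q t η)
                          (nbrs-nonzero : ∀ w → Edge G u w → ¬ toℕ (η (old w)) ≡ 0) where

        η≗start : ∀ A → (∀ i → i ≤ t → A i ≡ suc i * q) → toℕ (η (old u)) ≡ 0 →
                  ∀ z → η z ≡ repaint 0 (λ _ → paths A in-init) z
        η≗start A A≡ u≡0 (old v) with v ≟ᶠ u
        ... | yes refl = ≡-mod {m = 0} u≡0 refl
        ... | no _ = refl
        η≗start A A≡ u≡0 (yv i) = refl
        η≗start A A≡ u≡0 (xv a b e i) with a ≟ᶠ u | b ≟ᶠ u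
        ... | yes refl | _ = ≡-mod (trans (proj₁ (η-std u b e) u≡0 i) (cong (λ z → (z * q) % p) (+-comm (toℕ i) 1)))
                                   (A≡ (toℕ i) (s≤s⁻¹ (toℕ<n i)))
        ... | no _ | yes refl with <t⊎≡fromℕ i
        ...   | inj₁ i<t = ≡-mod (proj₁ (proj₁ (proj₂ (η-std a u e)) u≡0) i i<t) (in-ending-lo (toℕ i) i<t)
        ...   | inj₂ refl = ≡-mod (proj₂ (proj₁ (proj₂ (η-std a u e)) u≡0)) (trans (cong in-init (toℕ-fromℕ t)) in-ending-t)
        η≗start A A≡ u≡0 (xv a b e i) | no _ | no _ = refl

        η≗final : ∀ U → toℕ (η (old u)) ≡ U % p → ¬ U % p ≡ 0 → ∀ z → η z ≡ repaint U (λ _ → final) z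
        η≗final U u≡U U≢0 (old v) with v ≟ᶠ u
        ... | yes refl = ≡-mod {m = U} u≡U refl
        ... | no _ = refl
        η≗final U u≡U U≢0 (yv i) = refl
        η≗final U u≡U U≢0 (xv a b e i) with a ≟ᶠ u | b ≟ᶠ u
        ... | yes refl | _ with <t⊎≡fromℕ i
        ...   | inj₁ i<t = ≡-mod (proj₁ (proj₂ (proj₂ (η-std u b e)) u≢0 (nbrs-nonzero b e)) i i<t) (if-< i<t)
          where u≢0 = λ u≡0 → U≢0 (trans (sym u≡U) u≡0)
        ...   | inj₂ refl = ≡-mod (proj₂ (proj₂ (proj₂ (η-std u b e)) u≢0 (nbrs-nonzero b e)))
                                  (trans (cong out-final (toℕ-fromℕ t)) (if-≮ (n≮n t)))
          where u≢0 = λ u≡0 → U≢0 (trans (sym u≡U) u≡0)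
        η≗final U u≡U U≢0 (xv a b e i) | no _ | yes refl with <t⊎≡fromℕ i
        ...   | inj₁ i<t = ≡-mod (proj₁ (proj₂ (proj₂ (η-std a u e)) (nbrs-nonzero a (Edge-sym e)) u≢0) i i<t)
                                 (in-ending-lo (toℕ i) i<t)
          where u≢0 = λ u≡0 → U≢0 (trans (sym u≡U) u≡0)
        ...   | inj₂ refl = ≡-mod (proj₂ (proj₂ (proj₂ (η-std a u e)) (nbrs-nonzero a (Edge-sym e)) u≢0))
                                  (trans (cong in-final (toℕ-fromℕ t)) in-ending-t)
          where u≢0 = λ u≡0 → U≢0 (trans (sym u≡U) u≡0)
        η≗final U u≡U U≢0 (xv a b e i) | no _ | no _ = refl

        start-standard : ∀ A → (∀ i → i ≤ t → A i ≡ suc i * q) → Standard G p q t (repaint 0 (λ _ → paths A in-init))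
        start-standard A A≡ a b e with a ≟ᶠ u | b ≟ᶠ u
        ... | yes refl | yes refl = ⊥-elim (Edge-irrefl e)
        ... | yes refl | no _ =
              (λ _ i → trans (toℕ-mod (A (toℕ i))) (cong (_% p) (trans (A≡ (toℕ i) (s≤s⁻¹ (toℕ<n i))) (cong (_* q) (+-comm 1 (toℕ i))))))
            , (λ b≡0 → ⊥-elim (nbrs-nonzero b e b≡0))
            , (λ u≢0 → ⊥-elim (u≢0 (toℕ-mod 0)))
        ... | no _ | yes refl =
              (λ a≡0 → ⊥-elim (nbrs-nonzero a (Edge-sym e) a≡0))
            , (λ _ → (λ i i<t → trans (toℕ-mod (in-init (toℕ i))) (cong (_% p) (in-ending-lo (toℕ i) i<t)))
                   , trans (toℕ-mod-cong in-init (toℕ-fromℕ t)) (cong (_% p) in-ending-t))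
            , (λ _ u≢0 → ⊥-elim (u≢0 (toℕ-mod 0)))
        ... | no _ | no _ = η-std a b e

        final-standard : ∀ U → ¬ U % p ≡ 0 → Standard G p q t (repaint U (λ _ → final))
        final-standard U U≢0 a b e with a ≟ᶠ u | b ≟ᶠ u
        ... | yes refl | yes refl = ⊥-elim (Edge-irrefl e)
        ... | yes refl | no _ =
              (λ u≡0 → ⊥-elim (U≢0 (trans (sym (toℕ-mod U)) u≡0)))
            , (λ b≡0 → ⊥-elim (nbrs-nonzero b e b≡0))
            , (λ _ _ → (λ i i<t → trans (toℕ-mod (out-final (toℕ i))) (cong (_% p) (if-< i<t)))
                     , trans (toℕ-mod-cong out-final (toℕ-fromℕ t)) (cong (_% p) (if-≮ (n≮n t))))
        ... | no _ | yes refl =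
              (λ a≡0 → ⊥-elim (nbrs-nonzero a (Edge-sym e) a≡0))
            , (λ u≡0 → ⊥-elim (U≢0 (trans (sym (toℕ-mod U)) u≡0)))
            , (λ _ _ → (λ i i<t → trans (toℕ-mod (in-final (toℕ i))) (cong (_% p) (in-ending-lo (toℕ i) i<t)))
                     , trans (toℕ-mod-cong in-final (toℕ-fromℕ t)) (cong (_% p) in-ending-t))
        ... | no _ | no _ = η-std a b e

        recolour-from-0 : ∀ U A → (∀ i → i ≤ t → A i ≡ suc i * q) →
          IsPQColouring G p q t (repaint 0 (λ _ → paths A in-init)) →
          IsPQColouring G p q t (repaint U (λ _ → final)) →
          Reconf G p q t (repaint 0 (λ _ → paths A in-init)) (repaint U (λ _ → final)) →
          ¬ U % p ≡ 0 → toℕ (η (old u)) ≡ 0 → Recolouring (U % p)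
        recolour-from-0 U A A≡ start-valid final-valid run U≢0 u≡0 =
          repaint U (λ _ → final) , final-valid , final-standard U U≢0 , repaint-centre U (λ _ → final) , repaint-old U (λ _ → final) ,
          (≗⇒Reconf (old u) start-valid (η≗start A A≡ u≡0) ++ run)

        recolour-to-0 : ∀ U A → (∀ i → i ≤ t → A i ≡ suc i * q) →
          IsPQColouring G p q t (repaint 0 (λ _ → paths A in-init)) →
          IsPQColouring G p q t (repaint U (λ _ → final)) →
          Reconf G p q t (repaint 0 (λ _ → paths A in-init)) (repaint U (λ _ → final)) →
          ¬ U % p ≡ 0 → toℕ (η (old u)) ≡ U % p → Recolouring 0
        recolour-to-0 U A A≡ start-valid final-valid run U≢0 u≡U =
          repaint 0 (λ _ → paths A in-init) , start-valid , start-standard A A≡ , repaint-centre 0 (λ _ → paths A in-init) , repaint-old 0 (λ _ → paths A in-init) ,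
          (≗⇒Reconf (old u) final-valid (η≗final U u≡U U≢0) ++ reverse start-valid run)

      module Direct (β : ℕ) (β<k : suc β < 4 + k') (η-std : Standard G p q t η)
                    (u≢0 : ¬ toℕ (η (old u)) ≡ 0)
                    (nbrs : ∀ w → Edge G u w → toℕ (η (old w)) ≡ 0
                                  ⊎ Σ ℕ λ c → suc c < 4 + k' × ¬ suc c ≡ suc β × toℕ (η (old w)) ≡ (suc c * q + r) % p) where
        γb = suc β * q + r

        recoloured : V' G p t → Fin p
        recoloured (old v) with v ≟ᶠ u
        ... | yes _ = γb mod p
        ... | no _ = η (old v)
        recoloured (yv i) = η (yv i)
        recoloured (xv a b e i) = η (xv a b e i)

        first-0 : ∀ w (e : Edge G u w) → toℕ (η (xv u w e fzero)) ≡ 0 % p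
        first-0 w e with toℕ (η (old w)) ≟ 0
        ... | yes w≡0 = proj₁ (proj₁ (proj₂ (η-std u w e)) w≡0) fzero (s≤s z≤n)
        ... | no w≢0 = proj₁ (proj₂ (proj₂ (η-std u w e)) u≢0 w≢0) fzero (s≤s z≤n)

        far-nbr : ∀ w → Edge G u w → FarApart p q (γb mod p) (η (old w))
        far-nbr w e with nbrs w e
        ... | inj₁ w≡0 = farApart (far-γ-0 β β<k) (toℕ-mod γb) w≡0
        ... | inj₂ (c , c<k , c≢β , w≡c) = farApart (far-γ-γ β c β<k c<k λ c≡β → c≢β (cong suc c≡β)) (toℕ-mod γb) w≡c

        far-last : ∀ w (e : Edge G w u) → FarApart p q (γb mod p) (η (xv w u e (fromℕ t)))
        far-last w e with toℕ (η (old w)) ≟ 0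
        ... | yes w≡0 = farApart (far-γ-[t+1]q β β<k) (toℕ-mod γb)
                          (trans (proj₁ (η-std w u e) w≡0 (fromℕ t))
                                 (cong (λ x → (x * q) % p) (trans (cong (_+ 1) (toℕ-fromℕ t)) (+-comm t 1))))
        ... | no w≢0 = farApart (far-γ-0 β β<k) (toℕ-mod γb) (proj₂ (proj₂ (proj₂ (η-std w u e)) w≢0 u≢0))

        recoloured-gen : ∀ {x y} → Gen G p q t x y → FarApart p q (recoloured x) (recoloured y)
        recoloured-gen (e-old {a} {b} e) with a ≟ᶠ u | b ≟ᶠ u
        ... | yes refl | yes refl = ⊥-elim (Edge-irrefl e)
        ... | yes refl | no _ = far-nbr b e
        ... | no _ | yes refl = FarApart-sym (γb mod p) (η (old a)) (far-nbr a (Edge-sym e))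
        ... | no _ | no _ = η-valid _ _ (inj₁ (e-old e))
        recoloured-gen (e-y x y) = η-valid _ _ (inj₁ (e-y x y))
        recoloured-gen (e-u {a} {b} e) with a ≟ᶠ u
        ... | yes refl = farApart (far-γ-0 β β<k) (toℕ-mod γb) (first-0 b e)
        ... | no _ = η-valid _ _ (inj₁ (e-u e))
        recoloured-gen (e-path e i) = η-valid _ _ (inj₁ (e-path e i))
        recoloured-gen (e-v {a} {b} e) with b ≟ᶠ u
        ... | yes refl = FarApart-sym (γb mod p) (η (xv a u e (fromℕ t))) (far-last a e)
        ... | no _ = η-valid _ _ (inj₁ (e-v e))
        recoloured-gen (e-y0 e j∈) = η-valid _ _ (inj₁ (e-y0 e j∈))
        recoloured-gen (e-yt e j∈) = η-valid _ _ (inj₁ (e-yt e j∈))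
        recoloured-gen (e-yi e i 1≤i i≤ j∈) = η-valid _ _ (inj₁ (e-yi e i 1≤i i≤ j∈))

        recoloured-valid : IsPQColouring G p q t recoloured
        recoloured-valid x y (inj₁ g) = recoloured-gen g
        recoloured-valid x y (inj₂ g) = FarApart-sym (recoloured y) (recoloured x) (recoloured-gen g)

        γb<p : γb < p
        γb<p = γ<p β<k

        centre≢0 : ¬ toℕ (γb mod p) ≡ 0
        centre≢0 γb≡0 with trans (sym (m<n⇒m%n≡m γb<p)) (trans (sym (toℕ-mod γb)) γb≡0)
        ... | ()

        recoloured-standard : Standard G p q t recoloured
        recoloured-standard a b e with a ≟ᶠ u | b ≟ᶠ u
        ... | yes refl | yes refl = ⊥-elim (Edge-irrefl e)
        ... | yes refl | no _ = (λ γb≡0 → ⊥-elim (centre≢0 γb≡0)) , proj₁ (proj₂ (η-std u b e))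
                              , (λ _ b≢0 → proj₂ (proj₂ (η-std u b e)) u≢0 b≢0)
        ... | no _ | yes refl = proj₁ (η-std a u e) , (λ γb≡0 → ⊥-elim (centre≢0 γb≡0))
                              , (λ a≢0 _ → proj₂ (proj₂ (η-std a u e)) a≢0 u≢0)
        ... | no _ | no _ = η-std a b e

        recolouring : Recolouring γb
        recolouring = recoloured , recoloured-valid , recoloured-standard , centre , unchanged ,
                      one-step recoloured-valid (old u , same)
          where
            centre : toℕ (recoloured (old u)) ≡ γb
            centre with u ≟ᶠ u
            ... | yes _ = trans (toℕ-mod γb) (m<n⇒m%n≡m γb<p)
            ... | no u≢u = ⊥-elim (u≢u refl)
            unchanged : ∀ v → ¬ v ≡ u → recoloured (old v) ≡ η (old v)
            unchanged v v≢u with v ≟ᶠ u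
            ... | yes v≡u = ⊥-elim (v≢u v≡u)
            ... | no _ = refl
            same : ∀ z → ¬ z ≡ old u → η z ≡ recoloured z
            same (old v) z≢u with v ≟ᶠ u
            ... | yes refl = ⊥-elim (z≢u refl)
            ... | no _ = refl
            same (yv i) _ = refl
            same (xv a b e i) _ = refl

    module SingleVertex (G : Graph) (h h' : Fin (n G) → Fin (4 + k'))
      (h-proper : IsKColouring G (4 + k') h) (h'-proper : IsKColouring G (4 + k') h')
      (u : Fin (n G)) (hu≢h'u : ¬ h u ≡ h' u) (h≡h' : ∀ w → ¬ w ≡ u → h w ≡ h' w)
      (η : V' G p t → Fin p) (η-valid : IsPQColouring G p q t η) (η-std : Standard G p q t η)
      (η-y : ∀ i → η (yv i) ≡ i) (η-old : ∀ v → toℕ (η (old v)) ≡ γ q r (toℕ (h v))) where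
      open EdgeFacts G
      open Schedules G u η η-valid η-y

      nbr≢u : ∀ {w} → Edge G u w → ¬ w ≡ u
      nbr≢u e refl = Edge-irrefl e

      nbr≢hu : ∀ w → Edge G u w → ¬ toℕ (h w) ≡ toℕ (h u)
      nbr≢hu w e hw≡hu = h-proper u w e (sym (toℕ-injective hw≡hu))

      nbr≢h'u : ∀ w → Edge G u w → ¬ toℕ (h w) ≡ toℕ (h' u)
      nbr≢h'u w e hw≡h'u = h'-proper u w e (sym (toℕ-injective (trans (cong toℕ (sym (h≡h' w (nbr≢u e)))) hw≡h'u)))

      η-nonzero-old : ∀ w c → toℕ (h w) ≡ suc c → toℕ (η (old w)) ≡ (suc c * q + r) % p
      η-nonzero-old w c hw≡ = trans (η-old w) (trans (cong (γ q r) hw≡)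
        (sym (m<n⇒m%n≡m (γ<p (subst (_< 4 + k') hw≡ (toℕ<n (h w)))))))

      avoiding : ∀ b → (∀ w → Edge G u w → ¬ toℕ (h w) ≡ 0) → (∀ w → Edge G u w → ¬ toℕ (h w) ≡ b) →
                 NeighboursAvoid b
      avoiding b ≢0 ≢b w e with toℕ (h w) in hw≡ | toℕ<n (h w)
      ... | zero | _ = ⊥-elim (≢0 w e hw≡)
      ... | suc c | c<k = c , c<k , (λ c≡b → ≢b w e (trans hw≡ c≡b)) , η-nonzero-old w c hw≡

      nbrs-nonzero : ∀ {b} → NeighboursAvoid b → ∀ w → Edge G u w → ¬ toℕ (η (old w)) ≡ 0
      nbrs-nonzero avoid w e w≡0 with avoid w e
      ... | c , c<k , _ , w≡c with trans (sym (trans w≡c (m<n⇒m%n≡m (γ<p c<k)))) w≡0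
      ...   | ()

      Reconfigured : Set
      Reconfigured = Σ (V' G p t → Fin p) λ η' → IsPQColouring G p q t η' × Standard G p q t η'
        × (∀ v → toℕ (η' (old v)) ≡ γ q r (toℕ (h' v))) × Reconf G p q t η η'

      reconfigured : ∀ {U} → U ≡ γ q r (toℕ (h' u)) → Recolouring U → Reconfigured
      reconfigured U≡ (η' , valid , std , centre , unchanged , reconf) = η' , valid , std , old-colours , reconf
        where
          old-colours : ∀ v → toℕ (η' (old v)) ≡ γ q r (toℕ (h' v))
          old-colours v with v ≟ᶠ u
          ... | yes refl = trans centre U≡
          ... | no v≢u = trans (cong toℕ (unchanged v v≢u)) (trans (η-old v) (cong (γ q r ∘ toℕ) (h≡h' v v≢u)))
            where open import Function using (_∘_)

      γ-mod : ∀ {c} → c < 4 + k' → γ q r c % p ≡ γ q r c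
      γ-mod c<k = m<n⇒m%n≡m (γ<p c<k)

      γ-suc≢0 : ∀ {c} → ¬ γ q r (suc c) ≡ 0
      γ-suc≢0 ()

      γ-suc-mod≢0 : ∀ {c} → suc c < 4 + k' → ¬ γ q r (suc c) % p ≡ 0
      γ-suc-mod≢0 {c} c<k γ≡0 = γ-suc≢0 {c} (trans (sym (γ-mod c<k)) γ≡0)

      q+r≡γ1 : q + r ≡ γ q r 1
      q+r≡γ1 = cong (_+ r) (sym 1*q≡q)

      1<k : 1 < 4 + k'
      1<k = s≤s (s≤s z≤n)

      q+r-mod : (q + r) % p ≡ γ q r 1
      q+r-mod = trans (cong (_% p) q+r≡γ1) (γ-mod 1<k)

      by-colours : ∀ a b → toℕ (h u) ≡ a → toℕ (h' u) ≡ b → a < 4 + k' → b < 4 + k' → Reconfigured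
      by-colours zero zero hu≡ h'u≡ _ _ = ⊥-elim (hu≢h'u (toℕ-injective (trans hu≡ (sym h'u≡))))
      by-colours zero (suc zero) hu≡ h'u≡ _ _ =
        reconfigured (trans q+r-mod (cong (γ q r) (sym h'u≡)))
          (recolour-from-0 (q + r) _ (λ i i≤t → if-< (s≤s i≤t)) start-valid final-valid run
            (λ q+r≡0 → γ-suc≢0 {0} (trans (sym q+r-mod) q+r≡0)) (trans (η-old u) (cong (γ q r) hu≡)))
        where
          avoid = avoiding 1 (λ w e hw≡0 → nbr≢hu w e (trans hw≡0 (sym hu≡)))
                             (λ w e hw≡1 → nbr≢h'u w e (trans hw≡1 (sym h'u≡)))
          open ToOne avoid
          open FromStandard η-std (nbrs-nonzero avoid)
      by-colours zero (suc (suc b)) hu≡ h'u≡ _ b<k =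
        reconfigured (trans (γ-mod b<k) (cong (γ q r) (sym h'u≡)))
          (recolour-from-0 (γ q r (2 + b)) _ (λ _ _ → refl) start-valid final-valid run
            (γ-suc-mod≢0 b<k) (trans (η-old u) (cong (γ q r) hu≡)))
        where
          avoid = avoiding (2 + b) (λ w e hw≡0 → nbr≢hu w e (trans hw≡0 (sym hu≡)))
                                   (λ w e hw≡b → nbr≢h'u w e (trans hw≡b (sym h'u≡)))
          open ToLarge b b<k avoid
          open FromStandard η-std (nbrs-nonzero avoid)
      by-colours (suc zero) zero hu≡ h'u≡ _ _ =
        reconfigured (cong (γ q r) (sym h'u≡))
          (recolour-to-0 (q + r) _ (λ i i≤t → if-< (s≤s i≤t)) start-valid final-valid run
            (λ q+r≡0 → γ-suc≢0 {0} (trans (sym q+r-mod) q+r≡0))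
            (trans (η-old u) (trans (cong (γ q r) hu≡) (sym q+r-mod))))
        where
          avoid = avoiding 1 (λ w e hw≡0 → nbr≢h'u w e (trans hw≡0 (sym h'u≡)))
                             (λ w e hw≡1 → nbr≢hu w e (trans hw≡1 (sym hu≡)))
          open ToOne avoid
          open FromStandard η-std (nbrs-nonzero avoid)
      by-colours (suc (suc a)) zero hu≡ h'u≡ a<k _ =
        reconfigured (cong (γ q r) (sym h'u≡))
          (recolour-to-0 (γ q r (2 + a)) _ (λ _ _ → refl) start-valid final-valid run
            (γ-suc-mod≢0 a<k) (trans (η-old u) (trans (cong (γ q r) hu≡) (sym (γ-mod a<k)))))
        where
          avoid = avoiding (2 + a) (λ w e hw≡0 → nbr≢h'u w e (trans hw≡0 (sym h'u≡)))
                                   (λ w e hw≡a → nbr≢hu w e (trans hw≡a (sym hu≡)))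
          open ToLarge a a<k avoid
          open FromStandard η-std (nbrs-nonzero avoid)
      by-colours (suc a) (suc b) hu≡ h'u≡ _ b<k =
        reconfigured (cong (γ q r) (sym h'u≡)) (Direct.recolouring b b<k η-std u≢0 nbrs)
        where
          u≢0 : ¬ toℕ (η (old u)) ≡ 0
          u≢0 u≡0 = γ-suc≢0 {a} (trans (sym (trans (η-old u) (cong (γ q r) hu≡))) u≡0)
          nbrs : ∀ w → Edge G u w → toℕ (η (old w)) ≡ 0
                   ⊎ Σ ℕ λ c → suc c < 4 + k' × ¬ suc c ≡ suc b × toℕ (η (old w)) ≡ (suc c * q + r) % p
          nbrs w e with toℕ (h w) in hw≡ | toℕ<n (h w)
          ... | zero | _ = inj₁ (trans (η-old w) (cong (γ q r) hw≡))
          ... | suc c | c<k = inj₂ (c , c<k , (λ c≡b → nbr≢h'u w e (trans hw≡ (trans c≡b (sym h'u≡)))) ,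
                                   η-nonzero-old w c hw≡)

      reconfiguration : Reconfigured
      reconfiguration = by-colours _ _ refl refl (toℕ<n (h u)) (toℕ<n (h' u))

record NormalForm (p q k r t : ℕ) : Set where
  constructor normal-form
  field
    r0 s0 k' t0 : ℕ
    p≡ : p ≡ Normalised.p r0 s0 k' t0
    q≡ : q ≡ Normalised.q r0 s0 k' t0
    k≡ : k ≡ 4 + k'
    r≡ : r ≡ suc r0
    t≡ : t ≡ suc (suc t0)

normalise : ∀ {p q k r t} .{{_ : NonZero p}} .{{_ : NonZero q}} →
            4 * q ≤ p → k ≡ p / q → r ≡ p ∸ k * q → 1 ≤ r → IsT p q r t → NormalForm p q k r t
normalise {p} {q} {k} {suc r0} {t} 4q≤p k≡p/q r≡ (s≤s z≤n) (1≤t , [t+1]q≡r , _) =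
  normal-form r0 (q ∸ suc r) (k ∸ 4) (t ∸ 2) p≡ (sym (m+[n∸m]≡n r<q)) k≡4+k' refl (sym (m+[n∸m]≡n 2≤t))
  where
    r = suc r0
    r≡p%q : r ≡ p % q
    r≡p%q = trans r≡ (trans (cong (λ z → p ∸ z * q) k≡p/q) (sym (m%n≡m∸m/n*n p q)))
    r<q : r < q
    r<q = subst (_< q) (sym r≡p%q) (m%n<n p q)
    p≡kq+r : p ≡ k * q + r
    p≡kq+r = trans (m≡m%n+[m/n]*n p q) (trans (cong₂ (λ a b → a + b * q) (sym r≡p%q) (sym k≡p/q)) (+-comm r (k * q)))
    k≡4+k' : k ≡ 4 + (k ∸ 4)
    k≡4+k' = sym (m+[n∸m]≡n (subst₂ _≤_ (m*n/n≡m 4 q) (sym k≡p/q) (/-monoˡ-≤ q 4q≤p)))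
    p≡ : p ≡ Normalised.p r0 (q ∸ suc r) (k ∸ 4) (t ∸ 2)
    p≡ = trans p≡kq+r (cong₂ (λ a b → a * b + r) k≡4+k' (sym (m+[n∸m]≡n r<q)))
    2q<p : 2 * q < p
    2q<p = <-≤-trans (*-monoˡ-< q {2} {4} (s≤s (s≤s (s≤s z≤n)))) 4q≤p
    r<p : r < p
    r<p = <-≤-trans r<q (≤-trans (m≤m+n q (q + 0)) (<⇒≤ 2q<p))
    2≤t : 2 ≤ t
    2≤t = ≤∧≢⇒< 1≤t λ 1≡t → <⇒≱ r<q (≤-trans (m≤m+n q (q + 0)) (≤-reflexive (2q≡r 1≡t)))
      where
        2q≡r : 1 ≡ t → 2 * q ≡ r
        2q≡r refl = trans (sym (m<n⇒m%n≡m 2q<p)) (trans [t+1]q≡r (m<n⇒m%n≡m r<p))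

lemma3p4 : (p q k r t : ℕ) .{{_ : NonZero p}} .{{_ : NonZero q}} →
    4 * q ≤ p → k ≡ p / q → r ≡ p ∸ k * q → 1 ≤ r → IsT p q r t →
    (G : Graph) (h h' : Fin (n G) → Fin k) →
    IsKColouring G k h → IsKColouring G k h' →
    (u : Fin (n G)) → ¬ (h u ≡ h' u) → (∀ w → ¬ (w ≡ u) → h w ≡ h' w) →
    (η : V' G p t → Fin p) → IsPQColouring G p q t η → Standard G p q t η →
    (∀ i → η (yv i) ≡ i) → (∀ v → toℕ (η (old v)) ≡ γ q r (toℕ (h v))) →
    Σ (V' G p t → Fin p) λ η' → IsPQColouring G p q t η' × Standard G p q t η'
      × (∀ v → toℕ (η' (old v)) ≡ γ q r (toℕ (h' v))) × Reconf G p q t η η'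
lemma3p4 p q k r t 4q≤p k≡ r≡ 1≤r isT@(_ , [t+1]q≡r , _) G h h' h-proper h'-proper u hu≢h'u h≡h'
         η η-valid η-std η-y η-old
  with normalise 4q≤p k≡ r≡ 1≤r isT
... | normal-form r0 s0 k' t0 refl refl refl refl refl =
  SingleVertex.reconfiguration G h h' h-proper h'-proper u hu≢h'u h≡h' η η-valid η-std η-y η-old
  where
    open Normalised r0 s0 k' t0 using (module Main; %⇒≋)
    open Main (%⇒≋ (trans (cong (λ z → (z * q) % p) (+-comm 1 t)) [t+1]q≡r))
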